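{- There is a bijection between pasting schemes (up to isomorphism) and ps-contexts up to $\alpha$-equivalence (renaming of variables), and the functor $V$ restricts to an equivalence of categories $\mathrm{Syn}_{ps}\simeq\Theta_0^{op}$, where $\mathrm{Syn}_{ps}$ is the full subcategory of $\mathrm{Syn}(\mathsf{Glob})$ on the ps-contexts.
   Context: The type theory $\mathsf{Glob}$: terms are variables only; types are $\star$ or $t\to_A u$; contexts are lists $(x_1:A_1,\dots,x_n:A_n)$ and substitutions lists $\langle x_i\mapsto t_i\rangle$. Rules: empty context valid; $\Gamma\vdash A$ with $x$ fresh gives $(\Gamma,x:A)\vdash$; $\Gamma\vdash$ gives $\Gamma\vdash\star$; $\Gamma\vdash A$, $\Gamma\vdash t:A$, $\Gamma\vdash u:A$ give $\Gamma\vdash t\to_Au$; $\Gamma\vdash$ and $(x:A)\in\Gamma$ give $\Gamma\vdash x:A$; $\Delta\vdash$ gives $\Delta\vdash\langle\rangle:()$; $\Delta\vdash\gamma:\Gamma$, $(\Gamma,x:A)\vdash$, $\Delta\vdash t:A[\gamma]$ give $\Delta\vdash\langle\gamma,x\mapsto t\rangle:(\Gamma,x:A)$. $\mathrm{Syn}(\mathsf{Glob})$ has derivable contexts up to renaming as objects and derivable substitutions $\Delta\vdash\gamma:\Gamma$ as morphisms $\Delta\to\Gamma$. $\dim\star=-1$, $\dim(t\to_Au)=\dim A+1$. The functor $V:\mathrm{Syn}(\mathsf{Glob})\to\mathbf{FinGSet}^{op}$ sends $\Gamma=(x_i:A_i)$ to the finite globular set with $(V\Gamma)_n=\{x_i:\dim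 A_i=n-1\}$ and, for $x:y\to z$, $s(x)=y$, $t(x)=z$; it sends $\Delta\vdash\langle x_i\mapsto t_i\rangle:\Gamma$ to the map $V\Gamma\to V\Delta$, $x_i\mapsto t_i$. Ps-contexts: $(x:\star)\vdash_{ps}x:\star$; from $\Gamma\vdash_{ps}f:x\to_Ay$ infer $\Gamma\vdash_{ps}y:A$; from $\Gamma\vdash_{ps}x:A$ infer $(\Gamma,y:A,f:x\to_Ay)\vdash_{ps}f:x\to_Ay$ when $y,f\notin\mathrm{Var}\Gamma$; from $\Gamma\vdash_{ps}x:\star$ infer $\Gamma\vdash_{ps}$; a ps-context is a $\Gamma$ with $\Gamma\vdash_{ps}$. Globular sets are presheaves on the category $\mathbb G$ of globes (generators $\sigma_i,\tau_i:i\to i+1$ with $\sigma_{i+1}\sigma_i=\tau_{i+1}\sigma_i$, $\sigma_{i+1}\tau_i=\tau_{i+1}\tau_i$); $D^n$ is the representable at $n$. A pasting scheme is a globular set isomorphic to a colimit (globular sum) of a diagram $D^{i_1}\xleftarrow{\tau}D^{j_1}\xrightarrow{\sigma}D^{i_2}\xleftarrow{\tau}\cdots\xrightarrow{\sigma}D^{i_k}$ of iterated source/target maps; $\Theta_0$ is the full subcategory of globular sets on the pasting schemes. -}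

module Defs where

open import Data.Nat using (ℕ; zero; suc; _<_; _≟_; _≡ᵇ_)
open import Data.Nat.Properties using (<⇒≤; n<1+n; <-trans)
open import Data.Bool using (Bool; true; false; T)
open import Data.Bool.Properties using (T-irrelevant)
open import Data.Maybe using (Maybe; just; nothing)
open import Data.List using (List; []; _∷_)
open import Data.List.Relation.Unary.Any using (here; there)
open import Data.List.Membership.Propositional using (_∈_; _∉_)
open import Data.Product using (Σ; _×_; _,_; proj₁; proj₂)
open import Data.Fin using (Fin; inject₁) renaming (suc to fsuc)
open import Data.Empty using (⊥-elim)
open import Relation.Nullary using (yes; no)
open import Relation.Binary.PropositionalEquality using (_≡_; _≢_; refl; cong)
open import Function using (Injective)

-- Syntax of the type theory Glob (terms are variables, named by ℕ)

data Ty : Set where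
  ⋆ : Ty
  _⟶[_]_ : ℕ → Ty → ℕ → Ty

data Ctx : Set where
  ∅ : Ctx
  _▸_∶_ : Ctx → ℕ → Ty → Ctx

data Sub : Set where
  ⟨⟩ : Sub
  ⟨_,_↦_⟩ : Sub → ℕ → ℕ → Sub

Var : Ctx → List ℕ
Var ∅ = []
Var (Γ ▸ x ∶ A) = x ∷ Var Γ

data _∶_∈_ : ℕ → Ty → Ctx → Set where
  here  : ∀ {Γ x A} → x ∶ A ∈ (Γ ▸ x ∶ A)
  there : ∀ {Γ x A y B} → x ∶ A ∈ Γ → x ∶ A ∈ (Γ ▸ y ∶ B)

_[_]v : ℕ → Sub → ℕ
x [ ⟨⟩ ]v = x
x [ ⟨ γ , y ↦ t ⟩ ]v with x ≟ y
... | yes _ = t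
... | no _ = x [ γ ]v

_[_]T : Ty → Sub → Ty
⋆ [ γ ]T = ⋆
(t ⟶[ A ] u) [ γ ]T = (t [ γ ]v) ⟶[ A [ γ ]T ] (u [ γ ]v)

data _⊢ : Ctx → Set
data _⊢ty_ : Ctx → Ty → Set
data _⊢_∶_ : Ctx → ℕ → Ty → Set

data _⊢ where
  ec  : ∅ ⊢
  ext : ∀ {Γ x A} → Γ ⊢ty A → x ∉ Var Γ → (Γ ▸ x ∶ A) ⊢

data _⊢ty_ where
  star : ∀ {Γ} → Γ ⊢ → Γ ⊢ty ⋆
  arr  : ∀ {Γ A t u} → Γ ⊢ty A → Γ ⊢ t ∶ A → Γ ⊢ u ∶ A → Γ ⊢ty (t ⟶[ A ] u)

data _⊢_∶_ where
  var : ∀ {Γ x A} → Γ ⊢ → x ∶ A ∈ Γ → Γ ⊢ x ∶ A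

data _⊢s_∶_ : Ctx → Sub → Ctx → Set where
  es  : ∀ {Δ} → Δ ⊢ → Δ ⊢s ⟨⟩ ∶ ∅
  exs : ∀ {Δ γ Γ x A t} → Δ ⊢s γ ∶ Γ → (Γ ▸ x ∶ A) ⊢ → Δ ⊢ t ∶ (A [ γ ]T)
        → Δ ⊢s ⟨ γ , x ↦ t ⟩ ∶ (Γ ▸ x ∶ A)

data _⊢ps_∶_ : Ctx → ℕ → Ty → Set where
  pss : ∀ {x} → (∅ ▸ x ∶ ⋆) ⊢ps x ∶ ⋆
  pst : ∀ {Γ f x y A} → Γ ⊢ps f ∶ (x ⟶[ A ] y) → Γ ⊢ps y ∶ A
  pse : ∀ {Γ x A y f} → Γ ⊢ps x ∶ A → y ∉ Var Γ → f ∉ Var Γ → y ≢ f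
        → ((Γ ▸ y ∶ A) ▸ f ∶ (x ⟶[ A ] y)) ⊢ps f ∶ (x ⟶[ A ] y)

data _⊢ps : Ctx → Set where
  psc : ∀ {Γ x} → Γ ⊢ps x ∶ ⋆ → Γ ⊢ps

renT : (ℕ → ℕ) → Ty → Ty
renT ρ ⋆ = ⋆
renT ρ (t ⟶[ A ] u) = ρ t ⟶[ renT ρ A ] ρ u

renC : (ℕ → ℕ) → Ctx → Ctx
renC ρ ∅ = ∅
renC ρ (Γ ▸ x ∶ A) = renC ρ Γ ▸ ρ x ∶ renT ρ A

_≈α_ : Ctx → Ctx → Set
Γ ≈α Δ = Σ (ℕ → ℕ) λ ρ → Injective _≡_ _≡_ ρ × (Δ ≡ renC ρ Γ)

record GSet : Set₁ where
  field
    Cell : ℕ → Set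
    src  : ∀ {n} → Cell (suc n) → Cell n
    tgt  : ∀ {n} → Cell (suc n) → Cell n
    ss   : ∀ {n} (x : Cell (suc (suc n))) → src (src x) ≡ src (tgt x)
    tt   : ∀ {n} (x : Cell (suc (suc n))) → tgt (src x) ≡ tgt (tgt x)
open GSet public

record GHom (X Y : GSet) : Set where
  field
    fun     : ∀ {n} → Cell X n → Cell Y n
    fun-src : ∀ {n} (x : Cell X (suc n)) → fun (src X x) ≡ src Y (fun x)
    fun-tgt : ∀ {n} (x : Cell X (suc n)) → fun (tgt X x) ≡ tgt Y (fun x)
open GHom public

record _≅G_ (X Y : GSet) : Set where
  field
    to      : GHom X Y
    from    : GHom Y X
    from∘to : ∀ n (x : Cell X n) → fun from (fun to x) ≡ x
    to∘from : ∀ n (y : Cell Y n) → fun to (fun from y) ≡ y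
open _≅G_ public

-- The representable globular set Dᵏ = 𝔾(-, k):
-- for m < k there are two m-cells (false = source side, true = target side),
-- one k-cell (the identity), and nothing above k.

data DCell (k : ℕ) : ℕ → Set where
  bd  : ∀ {m} → .(m < k) → Bool → DCell k m
  top : DCell k k

dsrc : ∀ {k n} → DCell k (suc n) → DCell k n
dsrc (bd p b) = bd (<⇒≤ p) false
dsrc {n = n} top = bd (n<1+n n) false

dtgt : ∀ {k n} → DCell k (suc n) → DCell k n
dtgt (bd p b) = bd (<⇒≤ p) true
dtgt {n = n} top = bd (n<1+n n) true

D : ℕ → GSet
D k = record
  { Cell = DCell k ; src = dsrc ; tgt = dtgt
  ; ss = λ { (bd _ _) → refl ; top → refl }
  ; tt = λ { (bd _ _) → refl ; top → refl } }

-- Yoneda image of the iterated source (b = false) / target (b = true)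
-- morphism j → i of 𝔾, for j < i
incl : ∀ {j i} → Bool → j < i → GHom (D j) (D i)
incl {j} {i} b j<i = record
  { fun = f ; fun-src = λ { (bd _ _) → refl ; top → refl }
  ; fun-tgt = λ { (bd _ _) → refl ; top → refl } }
  where
  f : ∀ {n} → DCell j n → DCell i n
  f (bd p c) = bd (<-trans p j<i) c
  f top = bd j<i b

-- D^{i₀} ←τ D^{j₀} →σ D^{i₁} ←τ ⋯ →σ D^{i_len}
record Diagram : Set where
  field
    len  : ℕ
    dimI : Fin (suc len) → ℕ
    dimJ : Fin len → ℕ
    j<iL : ∀ p → dimJ p < dimI (inject₁ p)
    j<iR : ∀ p → dimJ p < dimI (fsuc p)
open Diagram public

record Cocone (𝒟 : Diagram) (X : GSet) : Set where
  field
    leg  : (p : Fin (suc (len 𝒟))) → GHom (D (dimI 𝒟 p)) X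
    comm : ∀ p {n} (x : DCell (dimJ 𝒟 p) n)
           → fun (leg (inject₁ p)) (fun (incl true (j<iL 𝒟 p)) x)
             ≡ fun (leg (fsuc p)) (fun (incl false (j<iR 𝒟 p)) x)
open Cocone public

Factors : ∀ {𝒟 X Y} → Cocone 𝒟 X → Cocone 𝒟 Y → GHom X Y → Set
Factors {𝒟} c d h = ∀ p n (x : DCell (dimI 𝒟 p) n) → fun h (fun (leg c p) x) ≡ fun (leg d p) x

IsColimit : ∀ {𝒟 X} → Cocone 𝒟 X → Set₁
IsColimit {𝒟} {X} c =
  ∀ (Y : GSet) (d : Cocone 𝒟 Y)
  → Σ (GHom X Y) (Factors c d)
    × (∀ (h h′ : GHom X Y) → Factors c d h → Factors c d h′ → ∀ n (x : Cell X n) → fun h x ≡ fun h′ x)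

IsPastingScheme : GSet → Set₁
IsPastingScheme X =
  Σ Diagram λ 𝒟 → Σ GSet λ L → Σ (Cocone 𝒟 L) λ c → IsColimit c × (X ≅G L)

lookupTy : Ctx → ℕ → Maybe Ty
lookupTy ∅ x = nothing
lookupTy (Γ ▸ y ∶ A) x with x ≟ y
... | yes _ = just A
... | no _ = lookupTy Γ x

-- dim A + 1  (so that ⋆ ↦ 0)
dim1 : Ty → ℕ
dim1 ⋆ = 0
dim1 (t ⟶[ A ] u) = suc (dim1 A)

isCellM : ℕ → Maybe Ty → Bool
isCellM n nothing = false
isCellM n (just A) = dim1 A ≡ᵇ n

-- (VΓ)ₙ = { x : (x : A) ∈ Γ, dim A = n - 1 }
VCell : Ctx → ℕ → Set
VCell Γ n = Σ ℕ λ x → T (isCellM n (lookupTy Γ x))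

sM : ℕ → Maybe Ty → ℕ
sM x (just (y ⟶[ A ] z)) = y
sM x _ = x

tM : ℕ → Maybe Ty → ℕ
tM x (just (y ⟶[ A ] z)) = z
tM x _ = x

srcName tgtName : Ctx → ℕ → ℕ
srcName Γ x = sM x (lookupTy Γ x)
tgtName Γ x = tM x (lookupTy Γ x)

ctxOf : ∀ {Γ A} → Γ ⊢ty A → Γ ⊢
ctxOf (star d) = d
ctxOf (arr t _ _) = ctxOf t

memVar : ∀ {Γ x A} → x ∶ A ∈ Γ → x ∈ Var Γ
memVar here = here refl
memVar (there m) = there (memVar m)

lookupVar : ∀ {Γ x A} → lookupTy Γ x ≡ just A → x ∈ Var Γ
lookupVar {∅} ()
lookupVar {Γ ▸ y ∶ B} {x} eq with x ≟ y
... | yes refl = here refl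
... | no _ = there (lookupVar eq)

weakenL : ∀ {Γ w B y A} → w ∉ Var Γ → lookupTy Γ y ≡ just A → lookupTy (Γ ▸ w ∶ B) y ≡ just A
weakenL {w = w} {y = y} fr eq with y ≟ w
... | yes refl = ⊥-elim (fr (lookupVar eq))
... | no _ = eq

memLookup : ∀ {Γ x A} → Γ ⊢ → x ∶ A ∈ Γ → lookupTy Γ x ≡ just A
memLookup {x = x} (ext tB fr) here with x ≟ x
... | yes _ = refl
... | no ¬p = ⊥-elim (¬p refl)
memLookup (ext tB fr) (there m) = weakenL fr (memLookup (ctxOf tB) m)

pair× : ∀ {A B C D : Set} → (A → C) → (B → D) → A × B → C × D
pair× f g (a , b) = f a , g b

keyT : ∀ {Γ y A z} → Γ ⊢ty (y ⟶[ A ] z) → lookupTy Γ y ≡ just A × lookupTy Γ z ≡ just A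
keyT (arr _ (var d m) (var d′ m′)) = memLookup d m , memLookup d′ m′

key : ∀ {Γ x y A z} → Γ ⊢ → lookupTy Γ x ≡ just (y ⟶[ A ] z)
      → lookupTy Γ y ≡ just A × lookupTy Γ z ≡ just A
key {x = x} (ext {x = w} tB fr) eq with x ≟ w
key (ext tB fr) refl | yes _ = pair× (weakenL fr) (weakenL fr) (keyT tB)
key (ext tB fr) eq | no _ = pair× (weakenL fr) (weakenL fr) (key (ctxOf tB) eq)

srcOK : ∀ {Γ n} x → Γ ⊢ → T (isCellM (suc n) (lookupTy Γ x)) → T (isCellM n (lookupTy Γ (srcName Γ x)))
srcOK {Γ} x d p with lookupTy Γ x in eq
... | just (y ⟶[ A ] z) rewrite proj₁ (key d eq) = p

tgtOK : ∀ {Γ n} x → Γ ⊢ → T (isCellM (suc n) (lookupTy Γ x)) → T (isCellM n (lookupTy Γ (tgtName Γ x)))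
tgtOK {Γ} x d p with lookupTy Γ x in eq
... | just (y ⟶[ A ] z) rewrite proj₂ (key d eq) = p

globN : ∀ {Γ n} x → Γ ⊢ → T (isCellM (suc (suc n)) (lookupTy Γ x))
        → (srcName Γ (srcName Γ x) ≡ srcName Γ (tgtName Γ x))
          × (tgtName Γ (srcName Γ x) ≡ tgtName Γ (tgtName Γ x))
globN {Γ} x d p with lookupTy Γ x in eq
... | just (y ⟶[ a ⟶[ B ] b ] z) with key d eq
...   | ey , ez rewrite ey | ez = refl , refl

cellEq : ∀ {Γ n} {c c′ : VCell Γ n} → proj₁ c ≡ proj₁ c′ → c ≡ c′
cellEq {c = x , p} {.x , q} refl = cong (x ,_) (T-irrelevant p q)

V : ∀ {Γ} → Γ ⊢ → GSet
V {Γ} d = record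
  { Cell = VCell Γ
  ; src = λ { (x , p) → srcName Γ x , srcOK x d p }
  ; tgt = λ { (x , p) → tgtName Γ x , tgtOK x d p }
  ; ss = λ { (x , p) → cellEq {Γ} (proj₁ (globN {Γ} x d p)) }
  ; tt = λ { (x , p) → cellEq {Γ} (proj₂ (globN {Γ} x d p)) } }

-- The ps-rules build a globular sum one disk at a time: a run of pst-steps moves the focus down to
-- the dimension j along which the next disk is glued, and a run of pse-steps glues on a disk of
-- dimension i. So every ps-context is, up to an injective renaming, the canonical context of a
-- diagram D^i₀ ← D^j₁ → ⋯ → D^iₙ, whose image under V is the colimit of that diagram; conversely
-- canonical contexts realise every pasting scheme. Fullness and faithfulness hold for all contexts:
-- a globular map V Γ → V Δ is a type-preserving map of variable names, i.e. a substitution.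
-- Finally an isomorphism V Γ ≅ V Δ of ps-contexts is a renaming: the variable introduced by the last
-- pse-step can be recognised inside V Γ, so the isomorphism matches the last steps, and induction
-- on the length of the context concludes.

module Submission where

open import Defs
open import Data.Nat using (ℕ; zero; suc; pred; _<_; _≤_; _<′_; ≤′-refl; ≤′-step; _≟_; _<?_; _+_; _∸_; z≤n; s≤s)
open import Data.Nat.Properties
  using ( ≡ᵇ⇒≡; ≡⇒≡ᵇ; ≡-irrelevant; <⇒≤; n<1+n; <-trans; <-irrefl; ≤-refl; ≤-trans; ≤-reflexive
        ; ≤-<-trans; m≤n⇒m≤1+n; n≤1+n; m≤m+n; m≤n+m; pred[m∸n]≡m∸[1+n]; m∸[m∸n]≡n; m∸n+n≡m
        ; m+n∸n≡m; +-∸-assoc; +-identityʳ; +-cancelˡ-≡; <⇒<′; <′⇒<; ∸-monoʳ-<; m∸n≢0⇒n<m; n>0⇒n≢0 )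
open import Data.Nat.ListAction using (sum)
open import Data.Bool using (Bool; true; false; T)
open import Data.Bool.Properties using (T-irrelevant)
open import Data.Maybe using (Maybe; just; nothing)
open import Data.Maybe.Properties using (just-injective)
import Data.Maybe as M
open import Data.List using (List; _∷_; length; map)
open import Data.List.Relation.Unary.Any using (here; there)
open import Data.List.Membership.Propositional using (_∈_; _∉_)
open import Data.List.Membership.DecPropositional _≟_ using (_∈?_)
open import Data.Fin using (Fin; inject₁; fromℕ) renaming (suc to fsuc; zero to fzero)
open import Data.Product using (Σ; _×_; _,_; proj₁; proj₂)
open import Data.Sum using (_⊎_; inj₁; inj₂; map₂)
open import Data.Unit using (⊤)
open import Data.Empty using (⊥; ⊥-elim)
open import Function using (Injective)
open import Relation.Nullary using (yes; no; ¬_; recompute)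
open import Relation.Binary.PropositionalEquality
  using (_≡_; _≢_; refl; cong; cong₂; sym; trans; subst; subst₂; subst-subst-sym)


⟶-cong : ∀ {a a′ B B′ b b′} → a ≡ a′ → B ≡ B′ → b ≡ b′ → (a ⟶[ B ] b) ≡ (a′ ⟶[ B′ ] b′)
⟶-cong refl refl refl = refl

⟶-injective : ∀ {a B b a′ B′ b′} → (a ⟶[ B ] b) ≡ (a′ ⟶[ B′ ] b′) → (a ≡ a′) × (B ≡ B′) × (b ≡ b′)
⟶-injective refl = refl , refl , refl

lookupTy-here : ∀ Γ y B → lookupTy (Γ ▸ y ∶ B) y ≡ just B
lookupTy-here Γ y B with y ≟ y
... | yes _ = refl
... | no y≢y = ⊥-elim (y≢y refl)

lookupTy-there : ∀ Γ {x y} B → x ≢ y → lookupTy (Γ ▸ y ∶ B) x ≡ lookupTy Γ x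
lookupTy-there Γ {x} {y} B x≢y with x ≟ y
... | yes x≡y = ⊥-elim (x≢y x≡y)
... | no _ = refl

sub-var-here : ∀ γ y t → y [ ⟨ γ , y ↦ t ⟩ ]v ≡ t
sub-var-here γ y t with y ≟ y
... | yes _ = refl
... | no y≢y = ⊥-elim (y≢y refl)

sub-var-there : ∀ γ {x y} t → x ≢ y → x [ ⟨ γ , y ↦ t ⟩ ]v ≡ x [ γ ]v
sub-var-there γ {x} {y} t x≢y with x ≟ y
... | yes x≡y = ⊥-elim (x≢y x≡y)
... | no _ = refl

lookupTy⇒∶∈ : ∀ {Γ x A} → lookupTy Γ x ≡ just A → x ∶ A ∈ Γ
lookupTy⇒∶∈ {∅} ()
lookupTy⇒∶∈ {Γ ▸ y ∶ B} {x} eq with x ≟ y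
lookupTy⇒∶∈ {Γ ▸ y ∶ B} {x} refl | yes refl = here
... | no _ = there (lookupTy⇒∶∈ eq)

∈Var⇒lookupTy : ∀ Γ {x} → x ∈ Var Γ → Σ Ty λ A → lookupTy Γ x ≡ just A
∈Var⇒lookupTy ∅ ()
∈Var⇒lookupTy (Γ ▸ y ∶ B) {x} m with x ≟ y
... | yes _ = B , refl
∈Var⇒lookupTy (Γ ▸ y ∶ B) {x} (here x≡y) | no x≢y = ⊥-elim (x≢y x≡y)
∈Var⇒lookupTy (Γ ▸ y ∶ B) {x} (there m) | no _ = ∈Var⇒lookupTy Γ m

isCell-intro : ∀ Γ {x A n} → lookupTy Γ x ≡ just A → dim1 A ≡ n → T (isCellM n (lookupTy Γ x))
isCell-intro Γ {A = A} eq refl rewrite eq = ≡⇒≡ᵇ (dim1 A) (dim1 A) refl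

isCell-elim : ∀ Γ {n} x → T (isCellM n (lookupTy Γ x)) → Σ Ty λ A → lookupTy Γ x ≡ just A × dim1 A ≡ n
isCell-elim Γ {n} x p with lookupTy Γ x
... | just A = A , refl , ≡ᵇ⇒≡ (dim1 A) n p

cellOf : ∀ {Γ x A} → lookupTy Γ x ≡ just A → VCell Γ (dim1 A)
cellOf {Γ} {x = x} eq = x , isCell-intro Γ eq refl

cell∈Var : ∀ Γ {n} (c : VCell Γ n) → proj₁ c ∈ Var Γ
cell∈Var Γ (x , p) = lookupVar (proj₁ (proj₂ (isCell-elim Γ x p)))

ext-fresh : ∀ {Γ x A} → (Γ ▸ x ∶ A) ⊢ → x ∉ Var Γ
ext-fresh (ext _ x∉Γ) = x∉Γ

ext-valid : ∀ {Γ x A} → (Γ ▸ x ∶ A) ⊢ → Γ ⊢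
ext-valid (ext A _) = ctxOf A

ext-ty : ∀ {Γ x A} → (Γ ▸ x ∶ A) ⊢ → Γ ⊢ty A
ext-ty (ext A _) = A

wk-ty : ∀ {Γ y B A} → Γ ⊢ty A → (Γ ▸ y ∶ B) ⊢ → (Γ ▸ y ∶ B) ⊢ty A
wk-tm : ∀ {Γ y B x A} → Γ ⊢ x ∶ A → (Γ ▸ y ∶ B) ⊢ → (Γ ▸ y ∶ B) ⊢ x ∶ A
wk-ty (star _) Γ′ = star Γ′
wk-ty (arr A t u) Γ′ = arr (wk-ty A Γ′) (wk-tm t Γ′) (wk-tm u Γ′)
wk-tm (var _ m) Γ′ = var Γ′ (there m)

ps-typed : ∀ {Γ x A} → Γ ⊢ps x ∶ A → Γ ⊢ty A × Γ ⊢ x ∶ A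
ps-typed pss = let Γ′ = ext (star ec) (λ ()) in star Γ′ , var Γ′ here
ps-typed (pst p) with ps-typed p
... | arr A t u , _ = A , u
ps-typed (pse {Γ} {x} {A} {y} {f} p y∉Γ f∉Γ y≢f) with ps-typed p
... | ⊢A , ⊢x = wk-ty ⊢x⟶y Γ″ , var Γ″ here
  where
  Γ′ = ext {x = y} ⊢A y∉Γ
  ⊢x⟶y = arr (wk-ty ⊢A Γ′) (wk-tm ⊢x Γ′) (var Γ′ here)
  f∉Γ′ : f ∉ Var (Γ ▸ y ∶ A)
  f∉Γ′ (here f≡y) = y≢f (sym f≡y)
  f∉Γ′ (there m) = f∉Γ m
  Γ″ = ext {x = f} ⊢x⟶y f∉Γ′

ps-ctx : ∀ {Γ x A} → Γ ⊢ps x ∶ A → Γ ⊢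
ps-ctx p = ctxOf (proj₁ (ps-typed p))

ps-lookup : ∀ {Γ x A} → Γ ⊢ps x ∶ A → lookupTy Γ x ≡ just A
ps-lookup p with ps-typed p
... | _ , var Γ m = memLookup Γ m

ps-valid : ∀ {Γ} → Γ ⊢ps → Γ ⊢
ps-valid (psc p) = ps-ctx p


-- Faithfulness and fullness

sub-ext : ∀ {Δ Γ γ γ′} → Δ ⊢s γ ∶ Γ → Δ ⊢s γ′ ∶ Γ
        → (∀ x → x ∈ Var Γ → x [ γ ]v ≡ x [ γ′ ]v) → γ ≡ γ′
sub-ext (es _) (es _) h = refl
sub-ext (exs {γ = γ} {x = x} {t = t} s d _) (exs {γ = γ′} {t = t′} s′ _ _) h =
  cong₂ (λ a b → ⟨ a , x ↦ b ⟩) (sub-ext s s′ agree-on-Γ)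
    (trans (sym (sub-var-here γ x t)) (trans (h x (here refl)) (sub-var-here γ′ x t′)))
  where
  agree-on-Γ : ∀ y → y ∈ Var _ → y [ γ ]v ≡ y [ γ′ ]v
  agree-on-Γ y m = trans (sym (sub-var-there γ t y≢x)) (trans (h y (there m)) (sub-var-there γ′ t′ y≢x))
    where
    y≢x : y ≢ x
    y≢x refl = ext-fresh d m

V-faithful : ∀ {Γ Δ γ γ′} (d : Γ ⊢) → Δ ⊢s γ ∶ Γ → Δ ⊢s γ′ ∶ Γ
           → (∀ n (c : Cell (V d) n) → proj₁ c [ γ ]v ≡ proj₁ c [ γ′ ]v)
           → γ ≡ γ′
V-faithful {Γ} d s s′ h = sub-ext s s′ λ x m →
  let (A , eq) = ∈Var⇒lookupTy Γ m in h (dim1 A) (cellOf {Γ} eq)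

sub-as-renT : ∀ {Γ A γ} (g : ℕ → ℕ) → Γ ⊢ty A → (∀ x → x ∈ Var Γ → x [ γ ]v ≡ g x) → A [ γ ]T ≡ renT g A
sub-as-renT g (star _) h = refl
sub-as-renT g (arr A (var _ m) (var _ m′)) h = ⟶-cong (h _ (memVar m)) (sub-as-renT g A h) (h _ (memVar m′))

sub-from-names : ∀ {Γ Δ} (g : ℕ → ℕ) → Γ ⊢ → Δ ⊢
               → (∀ x A → x ∶ A ∈ Γ → lookupTy Δ (g x) ≡ just (renT g A))
               → Σ Sub λ γ → (Δ ⊢s γ ∶ Γ) × (∀ x → x ∈ Var Γ → x [ γ ]v ≡ g x)
sub-from-names g ec Δ _ = ⟨⟩ , es Δ , λ x ()
sub-from-names {Γ ▸ x ∶ A} g d Δ g-typed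
  with sub-from-names g (ext-valid d) Δ (λ y B m → g-typed y B (there m))
... | γ , ⊢γ , γ≗g = ⟨ γ , x ↦ g x ⟩ , exs ⊢γ d ⊢gx , γ′≗g
  where
  ⊢gx = var Δ (lookupTy⇒∶∈ (trans (g-typed x A here) (cong just (sym (sub-as-renT g (ext-ty d) γ≗g)))))
  γ′≗g : ∀ y → y ∈ Var (Γ ▸ x ∶ A) → y [ ⟨ γ , x ↦ g x ⟩ ]v ≡ g y
  γ′≗g y (here refl) = sub-var-here γ y (g y)
  γ′≗g y (there m) = trans (sub-var-there γ (g x) (λ { refl → ext-fresh d m })) (γ≗g y m)

module NameMap {Γ Δ} (d : Γ ⊢) (e : Δ ⊢) (f : GHom (V d) (V e)) where
  nameOf : (x : ℕ) (m : Maybe Ty) → lookupTy Γ x ≡ m → ℕ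
  nameOf x nothing _ = x
  nameOf x (just A) eq = proj₁ (fun f (cellOf {Γ} eq))

  name : ℕ → ℕ
  name x = nameOf x (lookupTy Γ x) refl

  nameOf-spec : ∀ {n} x (p : T (isCellM n (lookupTy Γ x))) m (eq : lookupTy Γ x ≡ m)
              → proj₁ (fun f (x , p)) ≡ nameOf x m eq
  nameOf-spec x p nothing eq = ⊥-elim (subst (λ m → T (isCellM _ m)) eq p)
  nameOf-spec {n} x p (just A) eq with isCell-elim Γ x p
  ... | B , eqB , refl with trans (sym eqB) eq
  ... | refl = cong (λ c → proj₁ (fun f c)) (cellEq {Γ} refl)

  name-spec : ∀ {n} (c : VCell Γ n) → proj₁ (fun f c) ≡ name (proj₁ c)
  name-spec (x , p) = nameOf-spec x p (lookupTy Γ x) refl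

  isCell0⇒⋆ : ∀ {m} → T (isCellM 0 m) → m ≡ just ⋆
  isCell0⇒⋆ {just ⋆} _ = refl

  name-lookupTy : ∀ A x → lookupTy Γ x ≡ just A → lookupTy Δ (name x) ≡ just (renT name A)
  name-lookupTy ⋆ x eq =
    let c = cellOf {Γ} eq in
    trans (cong (lookupTy Δ) (sym (name-spec c))) (isCell0⇒⋆ (proj₂ (fun f c)))
  name-lookupTy (a ⟶[ B ] b) x eq = image-lookup (isCell-elim Δ (proj₁ fc) (proj₂ fc))
    where
    c = cellOf {Γ} eq
    fc = fun f c
    src-name : name a ≡ srcName Δ (proj₁ fc)
    src-name = trans (cong name (sym (cong (sM x) eq)))
                 (trans (sym (name-spec (src (V d) c))) (cong proj₁ (fun-src f c)))
    tgt-name : name b ≡ tgtName Δ (proj₁ fc)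
    tgt-name = trans (cong name (sym (cong (tM x) eq)))
                 (trans (sym (name-spec (tgt (V d) c))) (cong proj₁ (fun-tgt f c)))
    image-lookup : Σ Ty (λ A′ → lookupTy Δ (proj₁ fc) ≡ just A′ × dim1 A′ ≡ dim1 (a ⟶[ B ] b))
                 → lookupTy Δ (name x) ≡ just (renT name (a ⟶[ B ] b))
    image-lookup (⋆ , _ , ())
    image-lookup ((a′ ⟶[ B′ ] b′) , eq′ , _) =
      trans (cong (lookupTy Δ) (sym (name-spec c))) (trans eq′ (cong just (⟶-cong (sym a≡) B≡ (sym b≡))))
      where
      a≡ : name a ≡ a′
      a≡ = trans src-name (cong (sM (proj₁ fc)) eq′)
      b≡ : name b ≡ b′
      b≡ = trans tgt-name (cong (tM (proj₁ fc)) eq′)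
      B≡ : B′ ≡ renT name B
      B≡ = just-injective (trans (sym (proj₁ (key e eq′)))
             (trans (cong (lookupTy Δ) (sym a≡)) (name-lookupTy B a (proj₁ (key d eq)))))

V-full : ∀ {Γ Δ} (d : Γ ⊢) (e : Δ ⊢) (f : GHom (V d) (V e))
       → Σ Sub λ γ → (Δ ⊢s γ ∶ Γ) × (∀ n (c : Cell (V d) n) → proj₁ (fun f c) ≡ proj₁ c [ γ ]v)
V-full {Γ} d e f = γ , ⊢γ , λ n c → trans (name-spec c) (sym (γ≗name (proj₁ c) (cell∈Var Γ c)))
  where
  open NameMap d e f
  realised = sub-from-names name d e (λ x A m → name-lookupTy A x (memLookup d m))
  γ = proj₁ realised
  ⊢γ = proj₁ (proj₂ realised)
  γ≗name = proj₂ (proj₂ realised)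


InjOn : (ℕ → ℕ) → List ℕ → Set
InjOn ρ L = ∀ {x y} → x ∈ L → y ∈ L → ρ x ≡ ρ y → x ≡ y

inverse⇒≅G : ∀ {X Y} (h : GHom X Y) (k : ∀ {n} → Cell Y n → Cell X n)
           → (∀ n (x : Cell X n) → k (fun h x) ≡ x) → (∀ n (y : Cell Y n) → fun h (k y) ≡ y)
           → X ≅G Y
inverse⇒≅G {X} {Y} h k kh hk = record
  { to = h
  ; from = record { fun = k ; fun-src = fs ; fun-tgt = ft }
  ; from∘to = kh ; to∘from = hk }
  where
  fs : ∀ {n} (y : Cell Y (suc n)) → k (src Y y) ≡ src X (k y)
  fs {n} y = trans (cong (λ z → k (src Y z)) (sym (hk _ y)))
             (trans (cong k (sym (fun-src h (k y)))) (kh n (src X (k y))))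
  ft : ∀ {n} (y : Cell Y (suc n)) → k (tgt Y y) ≡ tgt X (k y)
  ft {n} y = trans (cong (λ z → k (tgt Y z)) (sym (hk _ y)))
             (trans (cong k (sym (fun-tgt h (k y)))) (kh n (tgt X (k y))))

idG : ∀ {X} → GHom X X
idG = record { fun = λ x → x ; fun-src = λ _ → refl ; fun-tgt = λ _ → refl }

_∘G_ : ∀ {X Y Z} → GHom Y Z → GHom X Y → GHom X Z
g ∘G f = record { fun = λ x → fun g (fun f x)
                ; fun-src = λ x → trans (cong (fun g) (fun-src f x)) (fun-src g (fun f x))
                ; fun-tgt = λ x → trans (cong (fun g) (fun-tgt f x)) (fun-tgt g (fun f x)) }

≅G-trans : ∀ {X Y Z} → X ≅G Y → Y ≅G Z → X ≅G Z
≅G-trans i j = record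
  { to = to j ∘G to i ; from = from i ∘G from j
  ; from∘to = λ n x → trans (cong (fun (from i)) (from∘to j n (fun (to i) x))) (from∘to i n x)
  ; to∘from = λ n x → trans (cong (fun (to j)) (to∘from i n (fun (from j) x))) (to∘from j n x) }

dim1-renT : ∀ ρ A → dim1 (renT ρ A) ≡ dim1 A
dim1-renT ρ ⋆ = refl
dim1-renT ρ (t ⟶[ A ] u) = cong suc (dim1-renT ρ A)

lookupTy-renC : ∀ ρ Γ {x} → InjOn ρ (Var Γ) → x ∈ Var Γ
              → lookupTy (renC ρ Γ) (ρ x) ≡ M.map (renT ρ) (lookupTy Γ x)
lookupTy-renC ρ ∅ inj ()
lookupTy-renC ρ (Γ ▸ y ∶ B) {x} inj m with x ≟ y
... | yes refl = lookupTy-here (renC ρ Γ) (ρ x) (renT ρ B)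
... | no x≢y = trans (lookupTy-there (renC ρ Γ) (renT ρ B) (λ e → x≢y (inj m (here refl) e)))
                     (lookupTy-renC ρ Γ (λ a b e → inj (there a) (there b) e) (x∈Γ m))
  where
  x∈Γ : x ∈ y ∷ Var Γ → x ∈ Var Γ
  x∈Γ (here x≡y) = ⊥-elim (x≢y x≡y)
  x∈Γ (there m) = m

Var-renC⁻¹ : ∀ ρ Γ {y} → y ∈ Var (renC ρ Γ) → Σ ℕ λ x → x ∈ Var Γ × ρ x ≡ y
Var-renC⁻¹ ρ ∅ ()
Var-renC⁻¹ ρ (Γ ▸ x ∶ A) (here e) = x , here refl , sym e
Var-renC⁻¹ ρ (Γ ▸ x ∶ A) (there m) with Var-renC⁻¹ ρ Γ m
... | z , mz , ez = z , there mz , ez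

sM-renT : ∀ ρ x m → sM (ρ x) (M.map (renT ρ) m) ≡ ρ (sM x m)
sM-renT ρ x nothing = refl
sM-renT ρ x (just ⋆) = refl
sM-renT ρ x (just (a ⟶[ A ] b)) = refl

tM-renT : ∀ ρ x m → tM (ρ x) (M.map (renT ρ) m) ≡ ρ (tM x m)
tM-renT ρ x nothing = refl
tM-renT ρ x (just ⋆) = refl
tM-renT ρ x (just (a ⟶[ A ] b)) = refl

module RenamingIso (ρ : ℕ → ℕ) (Γ : Ctx) (inj : InjOn ρ (Var Γ)) (d : Γ ⊢) (e : renC ρ Γ ⊢) where
  Δ = renC ρ Γ

  toF : ∀ {n} → VCell Γ n → VCell Δ n
  toF (x , p) =
    let (A , eq , dm) = isCell-elim Γ x p
        m = lookupVar eq
    in ρ x , isCell-intro Δ (trans (lookupTy-renC ρ Γ inj m) (cong (M.map (renT ρ)) eq)) (trans (dim1-renT ρ A) dm)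

  fromF : ∀ {n} → VCell Δ n → VCell Γ n
  fromF (y , q) =
    let (A′ , eq′ , dm) = isCell-elim Δ y q
        (x , mx , ex) = Var-renC⁻¹ ρ Γ (lookupVar eq′)
        (A , eqA) = ∈Var⇒lookupTy Γ mx
        e1 : M.map (renT ρ) (lookupTy Γ x) ≡ just A′
        e1 = trans (sym (lookupTy-renC ρ Γ inj mx)) (trans (cong (lookupTy Δ) ex) eq′)
        e2 : just (renT ρ A) ≡ just A′
        e2 = trans (cong (M.map (renT ρ)) (sym eqA)) e1
    in x , isCell-intro Γ eqA (trans (trans (sym (dim1-renT ρ A)) (cong dimM e2)) dm)
    where
    dimM : Maybe Ty → ℕ
    dimM nothing = 0
    dimM (just B) = dim1 B

  toH : GHom (V d) (V e)
  toH = record { fun = toF ; fun-src = fs ; fun-tgt = ft }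
    where
    fs : ∀ {n} (c : VCell Γ (suc n)) → toF (src (V d) c) ≡ src (V e) (toF c)
    fs (x , p) = cellEq {Δ} (sym (trans
      (cong (sM (ρ x)) (lookupTy-renC ρ Γ inj (cell∈Var Γ (x , p)))) (sM-renT ρ x (lookupTy Γ x))))
    ft : ∀ {n} (c : VCell Γ (suc n)) → toF (tgt (V d) c) ≡ tgt (V e) (toF c)
    ft (x , p) = cellEq {Δ} (sym (trans
      (cong (tM (ρ x)) (lookupTy-renC ρ Γ inj (cell∈Var Γ (x , p)))) (tM-renT ρ x (lookupTy Γ x))))

  iso : V d ≅G V e
  iso = inverse⇒≅G toH fromF
    (λ n c → cellEq {Γ} (inj (proj₁ (proj₂ (Var-renC⁻¹ ρ Γ (cell∈Var Δ (toF c))))) (cell∈Var Γ c)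
                        (proj₂ (proj₂ (Var-renC⁻¹ ρ Γ (cell∈Var Δ (toF c)))))))
    (λ n c → cellEq {Δ} (proj₂ (proj₂ (Var-renC⁻¹ ρ Γ (cell∈Var Δ c)))))

renaming⇒≅G : ∀ {Γ Δ} (d : Γ ⊢) (e : Δ ⊢) (ρ : ℕ → ℕ) → InjOn ρ (Var Γ) → Δ ≡ renC ρ Γ → V d ≅G V e
renaming⇒≅G {Γ} d e ρ inj refl = RenamingIso.iso ρ Γ inj d e

≈α⇒≅G : ∀ {Γ Δ} (d : Γ ⊢) (e : Δ ⊢) → Γ ≈α Δ → V d ≅G V e
≈α⇒≅G d e (ρ , ρ-injective , Δ≡ρΓ) = renaming⇒≅G d e ρ (λ _ _ → ρ-injective) Δ≡ρΓ


-- Faces of cells and globular sums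

<′-irrelevant : ∀ {m n} (p q : m <′ n) → p ≡ q
<′-irrelevant ≤′-refl ≤′-refl = refl
<′-irrelevant ≤′-refl (≤′-step q) = ⊥-elim (<-irrefl refl (<′⇒< q))
<′-irrelevant (≤′-step p) ≤′-refl = ⊥-elim (<-irrefl refl (<′⇒< p))
<′-irrelevant (≤′-step p) (≤′-step q) = cong ≤′-step (<′-irrelevant p q)

<′-recompute : ∀ {m n} → .(m < n) → m <′ n
<′-recompute p = <⇒<′ (recompute (_ <? _) p)

srcOrTgt : (X : GSet) → Bool → ∀ {n} → Cell X (suc n) → Cell X n
srcOrTgt X false = src X
srcOrTgt X true = tgt X

-- face X c q b: take sources down to dimension m + 1, then the source (b = false) or target (b = true).
face : (X : GSet) → ∀ {i m} → Cell X i → m <′ i → Bool → Cell X m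
face X c ≤′-refl b = srcOrTgt X b c
face X c (≤′-step q) b = face X (src X c) q b

face-src : ∀ (X : GSet) {i n} (c : Cell X i) (q : suc n <′ i) (q′ : n <′ i) b
         → face X c q′ false ≡ src X (face X c q b)
face-src X c ≤′-refl (≤′-step ≤′-refl) false = refl
face-src X c ≤′-refl (≤′-step ≤′-refl) true = ss X c
face-src X c ≤′-refl (≤′-step (≤′-step q′)) b = ⊥-elim (<-irrefl refl (<′⇒< q′))
face-src X c (≤′-step q) ≤′-refl b = ⊥-elim (<-irrefl refl (<-trans (n<1+n _) (<′⇒< q)))
face-src X c (≤′-step q) (≤′-step q′) b = face-src X (src X c) q q′ b

face-tgt : ∀ (X : GSet) {i n} (c : Cell X i) (q : suc n <′ i) (q′ : n <′ i) b
         → face X c q′ true ≡ tgt X (face X c q b)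
face-tgt X c ≤′-refl (≤′-step ≤′-refl) false = refl
face-tgt X c ≤′-refl (≤′-step ≤′-refl) true = tt X c
face-tgt X c ≤′-refl (≤′-step (≤′-step q′)) b = ⊥-elim (<-irrefl refl (<′⇒< q′))
face-tgt X c (≤′-step q) ≤′-refl b = ⊥-elim (<-irrefl refl (<-trans (n<1+n _) (<′⇒< q)))
face-tgt X c (≤′-step q) (≤′-step q′) b = face-tgt X (src X c) q q′ b

face-natural : ∀ {X Y} (g : GHom X Y) {i m} (c : Cell X i) (q : m <′ i) b
             → fun g (face X c q b) ≡ face Y (fun g c) q b
face-natural g c ≤′-refl false = fun-src g c
face-natural g c ≤′-refl true = fun-tgt g c
face-natural {X} {Y} g c (≤′-step q) b =
  trans (face-natural g (src X c) q b) (cong (λ z → face Y z q b) (fun-src g c))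

faceAt : (X : GSet) → ∀ {i n} → Cell X i → DCell i n → Cell X n
faceAt X c (bd p b) = face X c (<′-recompute p) b
faceAt X c top = c

cellMap : (X : GSet) → ∀ {i} → Cell X i → GHom (D i) X
cellMap X {i} c = record { fun = faceAt X c ; fun-src = faceAt-src ; fun-tgt = faceAt-tgt }
  where
  faceAt-src : ∀ {n} (x : DCell i (suc n)) → faceAt X c (dsrc x) ≡ src X (faceAt X c x)
  faceAt-src (bd p b) = face-src X c (<′-recompute p) (<′-recompute _) b
  faceAt-src top = cong (λ q → face X c q false) (<′-irrelevant (<′-recompute _) ≤′-refl)
  faceAt-tgt : ∀ {n} (x : DCell i (suc n)) → faceAt X c (dtgt x) ≡ tgt X (faceAt X c x)
  faceAt-tgt (bd p b) = face-tgt X c (<′-recompute p) (<′-recompute _) b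
  faceAt-tgt top = cong (λ q → face X c q true) (<′-irrelevant (<′-recompute _) ≤′-refl)

D-face-bd : ∀ {k i m} .(p : i < k) (c : Bool) (q : m <′ i) b .(r : m < k) → face (D k) (bd p c) q b ≡ bd r b
D-face-bd p c ≤′-refl false r = refl
D-face-bd p c ≤′-refl true r = refl
D-face-bd p c (≤′-step q) b r = D-face-bd _ false q b r

D-face-top : ∀ {i m} (q : m <′ i) b .(r : m < i) → face (D i) top q b ≡ bd r b
D-face-top ≤′-refl false r = refl
D-face-top ≤′-refl true r = refl
D-face-top (≤′-step q) b r = D-face-bd _ false q b r

D-map-via-top : ∀ {Y i} (g : GHom (D i) Y) {n} (x : DCell i n) → fun g x ≡ faceAt Y (fun g top) x
D-map-via-top g (bd p b) =
  trans (cong (fun g) (sym (D-face-top (<′-recompute p) b p))) (face-natural g top (<′-recompute p) b)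
D-map-via-top g top = refl

D-map-ext : ∀ {Y i} (g g′ : GHom (D i) Y) → fun g top ≡ fun g′ top
          → ∀ {n} (x : DCell i n) → fun g x ≡ fun g′ x
D-map-ext {Y} g g′ e x =
  trans (D-map-via-top g x) (trans (cong (λ z → faceAt Y z x) e) (sym (D-map-via-top g′ x)))

faceAt-src : ∀ (X : GSet) {m n} (c : Cell X (suc m)) (y : DCell m n)
           → faceAt X (src X c) y ≡ faceAt X c (fun (incl false (n<1+n m)) y)
faceAt-src X {m} c y = D-map-ext (cellMap X (src X c)) (cellMap X c ∘G incl false (n<1+n m))
                         (cong (λ q → face X c q false) (<′-irrelevant ≤′-refl (<′-recompute _))) y

faceAt-natural : ∀ {X Y} (g : GHom X Y) {i n} (c : Cell X i) (y : DCell i n)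
               → fun g (faceAt X c y) ≡ faceAt Y (fun g c) y
faceAt-natural {X} {Y} g c y = D-map-ext (g ∘G cellMap X c) (cellMap Y (fun g c)) refl y

Glues : (Y : GSet) (𝒟 : Diagram) (e : ∀ p → Cell Y (dimI 𝒟 p)) → Fin (len 𝒟) → Set
Glues Y 𝒟 e p = faceAt Y (e (inject₁ p)) (bd (j<iL 𝒟 p) true) ≡ faceAt Y (e (fsuc p)) (bd (j<iR 𝒟 p) false)

-- By the Yoneda lemma a cocone is a family of cells, one per disk, glued along the shared boundaries.
record CellColimit (𝒟 : Diagram) (X : GSet) : Set₁ where
  field
    cell : ∀ p → Cell X (dimI 𝒟 p)
    glue : ∀ p → Glues X 𝒟 cell p
    generate : ∀ n (x : Cell X n)
             → Σ (Fin (suc (len 𝒟))) λ p → Σ (DCell (dimI 𝒟 p) n) λ y → faceAt X (cell p) y ≡ x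
    extend : ∀ (Y : GSet) (e : ∀ p → Cell Y (dimI 𝒟 p)) → (∀ p → Glues Y 𝒟 e p)
           → Σ (GHom X Y) λ h → ∀ p → fun h (cell p) ≡ e p

CellColimit⇒IsColimit : ∀ {𝒟 X} → CellColimit 𝒟 X → Σ (Cocone 𝒟 X) IsColimit
CellColimit⇒IsColimit {𝒟} {X} cc = cocone , isColimit
  where
  open CellColimit cc
  cocone : Cocone 𝒟 X
  cocone = record
    { leg = λ p → cellMap X (cell p)
    ; comm = λ p → D-map-ext (cellMap X (cell (inject₁ p)) ∘G incl true (j<iL 𝒟 p))
                             (cellMap X (cell (fsuc p)) ∘G incl false (j<iR 𝒟 p)) (glue p) }
  isColimit : IsColimit cocone
  isColimit Y d = (h , factors) , unique
    where
    e : ∀ p → Cell Y (dimI 𝒟 p)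
    e p = fun (leg d p) top
    e-glues : ∀ p → Glues Y 𝒟 e p
    e-glues p = trans (sym (D-map-via-top (leg d (inject₁ p)) (bd (j<iL 𝒟 p) true)))
                  (trans (comm d p top) (D-map-via-top (leg d (fsuc p)) (bd (j<iR 𝒟 p) false)))
    h = proj₁ (extend Y e e-glues)
    factors : Factors cocone d h
    factors p n = D-map-ext (h ∘G cellMap X (cell p)) (leg d p) (proj₂ (extend Y e e-glues) p)
    unique : ∀ (h h′ : GHom X Y) → Factors cocone d h → Factors cocone d h′
           → ∀ n (x : Cell X n) → fun h x ≡ fun h′ x
    unique h h′ fh fh′ n x =
      let (p , y , eq) = generate n x in
      trans (cong (fun h) (sym eq)) (trans (fh p n y) (trans (sym (fh′ p n y)) (cong (fun h′) eq)))

colimit-unique : ∀ {𝒟 X X′} (c : Cocone 𝒟 X) → IsColimit c → (c′ : Cocone 𝒟 X′) → IsColimit c′ → X ≅G X′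
colimit-unique {𝒟} {X} {X′} c ic c′ ic′ = record { to = h ; from = k ; from∘to = kh ; to∘from = hk }
  where
  h = proj₁ (proj₁ (ic X′ c′))
  fh = proj₂ (proj₁ (ic X′ c′))
  k = proj₁ (proj₁ (ic′ X c))
  fk = proj₂ (proj₁ (ic′ X c))
  kh : ∀ n x → fun k (fun h x) ≡ x
  kh = proj₂ (ic X c) (k ∘G h) idG (λ p m y → trans (cong (fun k) (fh p m y)) (fk p m y)) (λ p m y → refl)
  hk : ∀ n x → fun h (fun k x) ≡ x
  hk = proj₂ (ic′ X′ c′) (h ∘G k) idG (λ p m y → trans (cong (fun h) (fk p m y)) (fh p m y)) (λ p m y → refl)


isCell-cast : ∀ Γ {n x x′} → x ≡ x′ → T (isCellM n (lookupTy Γ x)) → T (isCellM n (lookupTy Γ x′))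
isCell-cast Γ refl p = p

isCell-transport : ∀ Γ Γ′ {n} x → lookupTy Γ x ≡ lookupTy Γ′ x → T (isCellM n (lookupTy Γ x))
                 → T (isCellM n (lookupTy Γ′ x))
isCell-transport Γ Γ′ {n} x e p = subst (λ m → T (isCellM n m)) e p

isCell-dim : ∀ Γ x {n A} → lookupTy Γ x ≡ just A → T (isCellM n (lookupTy Γ x)) → dim1 A ≡ n
isCell-dim Γ x {n = n} {A = A} e p = ≡ᵇ⇒≡ (dim1 A) n (subst (λ m → T (isCellM n m)) e p)

module NewCell {Γ : Ctx} {z y f : ℕ} {Ty₀ : Ty} (d : Γ ⊢) (d′ : ((Γ ▸ y ∶ Ty₀) ▸ f ∶ (z ⟶[ Ty₀ ] y)) ⊢)
              (lz : lookupTy Γ z ≡ just Ty₀) where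
  Γ′ = (Γ ▸ y ∶ Ty₀) ▸ f ∶ (z ⟶[ Ty₀ ] y)

  f≢y : f ≢ y
  f≢y e = ext-fresh d′ (here e)
  f∉Γ : f ∉ Var Γ
  f∉Γ m = ext-fresh d′ (there m)
  y∉Γ : y ∉ Var Γ
  y∉Γ = ext-fresh (ext-valid d′)

  old≢y : ∀ {x} → x ∈ Var Γ → x ≢ y
  old≢y m refl = y∉Γ m
  old≢f : ∀ {x} → x ∈ Var Γ → x ≢ f
  old≢f m refl = f∉Γ m

  lookup-f : lookupTy Γ′ f ≡ just (z ⟶[ Ty₀ ] y)
  lookup-f = lookupTy-here _ f _
  lookup-y : lookupTy Γ′ y ≡ just Ty₀
  lookup-y = trans (lookupTy-there _ _ (λ e → f≢y (sym e))) (lookupTy-here Γ y Ty₀)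
  lookup-old : ∀ {x} → x ≢ f → x ≢ y → lookupTy Γ′ x ≡ lookupTy Γ x
  lookup-old a b = trans (lookupTy-there _ _ a) (lookupTy-there Γ Ty₀ b)

  z∈Var : z ∈ Var Γ
  z∈Var = lookupVar lz

  lookup-old-var : ∀ {x} → x ∈ Var Γ → lookupTy Γ′ x ≡ lookupTy Γ x
  lookup-old-var m = lookup-old (old≢f m) (old≢y m)

  lookup-old-cell : ∀ {n} (c : VCell Γ n) → lookupTy Γ′ (proj₁ c) ≡ lookupTy Γ (proj₁ c)
  lookup-old-cell c = lookup-old-var (cell∈Var Γ c)

  ι-fun : ∀ {n} → VCell Γ n → VCell Γ′ n
  ι-fun c = proj₁ c , isCell-transport Γ Γ′ (proj₁ c) (sym (lookup-old-cell c)) (proj₂ c)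

  ι : GHom (V d) (V d′)
  ι = record
    { fun = ι-fun
    ; fun-src = λ c → cellEq {Γ′} (cong (sM (proj₁ c)) (sym (lookup-old-cell c)))
    ; fun-tgt = λ c → cellEq {Γ′} (cong (tM (proj₁ c)) (sym (lookup-old-cell c))) }

  data Which (x : ℕ) : Set where
    is-f : x ≡ f → Which x
    is-y : x ≡ y → Which x
    is-old : x ≢ f → x ≢ y → Which x

  which : ∀ x → Which x
  which x with x ≟ f
  ... | yes e = is-f e
  ... | no a with x ≟ y
  ... | yes e = is-y e
  ... | no b = is-old a b

  classify : ∀ {n} (c : VCell Γ′ n) → (Σ (VCell Γ n) λ c′ → ι-fun c′ ≡ c) ⊎ ((proj₁ c ≡ f) ⊎ (proj₁ c ≡ y))
  classify (x , p) with which x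
  ... | is-f e = inj₂ (inj₁ e)
  ... | is-y e = inj₂ (inj₂ e)
  ... | is-old a b = inj₁ ((x , isCell-transport Γ′ Γ x (lookup-old a b) p) , cellEq {Γ′} refl)

  -- V Γ′ is V Γ with a disk glued along its source to the cell z, so a map out of it is a map h
  -- out of V Γ together with a cell E whose source is h z.
  module Extend (Y : GSet) (h : GHom (V d) Y) (E : Cell Y (suc (dim1 Ty₀)))
                (hE : src Y E ≡ fun h (cellOf {Γ} lz)) where
    castE : ∀ {n} → T (isCellM n (lookupTy Γ′ f)) → Cell Y n
    castE p = subst (Cell Y) (isCell-dim Γ′ f lookup-f p) E
    castY : ∀ {n} → T (isCellM n (lookupTy Γ′ y)) → Cell Y n
    castY p = subst (Cell Y) (isCell-dim Γ′ y lookup-y p) (tgt Y E)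

    H-at : ∀ {n} x → Which x → T (isCellM n (lookupTy Γ′ x)) → Cell Y n
    H-at x (is-f refl) p = castE p
    H-at x (is-y refl) p = castY p
    H-at x (is-old a b) p = fun h (x , isCell-transport Γ′ Γ x (lookup-old a b) p)

    H-at-irr : ∀ {n} x x′ (e : x ≡ x′) w w′ p p′ → H-at {n} x w p ≡ H-at x′ w′ p′
    H-at-irr x .x refl (is-f refl) (is-f refl) p p′ = cong castE (T-irrelevant p p′)
    H-at-irr x .x refl (is-f refl) (is-y e) p p′ = ⊥-elim (f≢y e)
    H-at-irr x .x refl (is-f refl) (is-old a b) p p′ = ⊥-elim (a refl)
    H-at-irr x .x refl (is-y refl) (is-f e) p p′ = ⊥-elim (f≢y (sym e))
    H-at-irr x .x refl (is-y refl) (is-y refl) p p′ = cong castY (T-irrelevant p p′)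
    H-at-irr x .x refl (is-y refl) (is-old a b) p p′ = ⊥-elim (b refl)
    H-at-irr x .x refl (is-old a b) (is-f e) p p′ = ⊥-elim (a e)
    H-at-irr x .x refl (is-old a b) (is-y e) p p′ = ⊥-elim (b e)
    H-at-irr x .x refl (is-old a b) (is-old a′ b′) p p′ = cong (λ q → fun h (x , q)) (T-irrelevant _ _)

    H : ∀ {n} → VCell Γ′ n → Cell Y n
    H (x , p) = H-at x (which x) p

    H-old : ∀ {n} (c : VCell Γ n) → H (ι-fun c) ≡ fun h c
    H-old c = trans (H-at-irr _ _ refl (which (proj₁ c)) (is-old (old≢f (cell∈Var Γ c)) (old≢y (cell∈Var Γ c)))
                              (proj₂ (ι-fun c)) (proj₂ (ι-fun c)))
                    (cong (fun h) (cellEq {Γ} refl))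

    H-name : ∀ {n} x (p : T (isCellM n (lookupTy Γ′ x))) w → H (x , p) ≡ H-at x w p
    H-name x p w = H-at-irr x x refl (which x) w p p

    E-src : ∀ {n} (eq : suc (dim1 Ty₀) ≡ suc n) (c : VCell Γ n) → proj₁ c ≡ z → fun h c ≡ src Y (subst (Cell Y) eq E)
    E-src refl c e = trans (cong (fun h) (cellEq {Γ} e)) (sym hE)

    subst-tgt : ∀ {n} (e1 : dim1 Ty₀ ≡ n) (e2 : suc (dim1 Ty₀) ≡ suc n)
              → subst (Cell Y) e1 (tgt Y E) ≡ tgt Y (subst (Cell Y) e2 E)
    subst-tgt refl e2 with ≡-irrelevant e2 refl
    ... | refl = refl

    tgtE-src : ∀ {n} (eq : dim1 Ty₀ ≡ suc n) (c : VCell Γ n) → proj₁ c ≡ srcName Γ z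
             → fun h c ≡ src Y (subst (Cell Y) eq (tgt Y E))
    tgtE-src {n} eq c e = go Ty₀ lz eq E hE
      where
      go : ∀ T′ (lz′ : lookupTy Γ z ≡ just T′) → ∀ (eq : dim1 T′ ≡ suc n) (E′ : Cell Y (suc (dim1 T′)))
         → src Y E′ ≡ fun h (cellOf {Γ} lz′) → fun h c ≡ src Y (subst (Cell Y) eq (tgt Y E′))
      go ⋆ _ () _ _
      go (a ⟶[ B ] b) lz′ refl E′ hE′ =
        trans (cong (fun h) (cellEq {Γ} e))
        (trans (fun-src h (cellOf {Γ} lz′)) (trans (cong (src Y) (sym hE′)) (ss Y E′)))

    tgtE-tgt : ∀ {n} (eq : dim1 Ty₀ ≡ suc n) (c : VCell Γ n) → proj₁ c ≡ tgtName Γ z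
             → fun h c ≡ tgt Y (subst (Cell Y) eq (tgt Y E))
    tgtE-tgt {n} eq c e = go Ty₀ lz eq E hE
      where
      go : ∀ T′ (lz′ : lookupTy Γ z ≡ just T′) → ∀ (eq : dim1 T′ ≡ suc n) (E′ : Cell Y (suc (dim1 T′)))
         → src Y E′ ≡ fun h (cellOf {Γ} lz′) → fun h c ≡ tgt Y (subst (Cell Y) eq (tgt Y E′))
      go ⋆ _ () _ _
      go (a ⟶[ B ] b) lz′ refl E′ hE′ =
        trans (cong (fun h) (cellEq {Γ} e))
        (trans (fun-tgt h (cellOf {Γ} lz′)) (trans (cong (tgt Y) (sym hE′)) (tt Y E′)))

    srcName-f : srcName Γ′ f ≡ z
    srcName-f = cong (sM f) lookup-f
    tgtName-f : tgtName Γ′ f ≡ y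
    tgtName-f = cong (tM f) lookup-f
    sM-arrow : ∀ {n} T′ a b → dim1 T′ ≡ suc n → sM a (just T′) ≡ sM b (just T′)
    sM-arrow ⋆ a b ()
    sM-arrow (_ ⟶[ _ ] _) a b _ = refl
    tM-arrow : ∀ {n} T′ a b → dim1 T′ ≡ suc n → tM a (just T′) ≡ tM b (just T′)
    tM-arrow ⋆ a b ()
    tM-arrow (_ ⟶[ _ ] _) a b _ = refl
    srcName-y : ∀ {n} → dim1 Ty₀ ≡ suc n → srcName Γ′ y ≡ srcName Γ z
    srcName-y e = trans (cong (sM y) lookup-y) (trans (sM-arrow Ty₀ y z e) (sym (cong (sM z) lz)))
    tgtName-y : ∀ {n} → dim1 Ty₀ ≡ suc n → tgtName Γ′ y ≡ tgtName Γ z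
    tgtName-y e = trans (cong (tM y) lookup-y) (trans (tM-arrow Ty₀ y z e) (sym (cong (tM z) lz)))

    srcName-z∈Var : ∀ {n} T′ → lookupTy Γ z ≡ just T′ → dim1 T′ ≡ suc n → srcName Γ z ∈ Var Γ
    srcName-z∈Var ⋆ _ ()
    srcName-z∈Var (a ⟶[ B ] b) e _ = subst (λ w → w ∈ Var Γ) (sym (cong (sM z) e)) (lookupVar (proj₁ (key d e)))
    tgtName-z∈Var : ∀ {n} T′ → lookupTy Γ z ≡ just T′ → dim1 T′ ≡ suc n → tgtName Γ z ∈ Var Γ
    tgtName-z∈Var ⋆ _ ()
    tgtName-z∈Var (a ⟶[ B ] b) e _ = subst (λ w → w ∈ Var Γ) (sym (cong (tM z) e)) (lookupVar (proj₂ (key d e)))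

    oldCell : ∀ {n} x (p : T (isCellM n (lookupTy Γ′ x))) (a : x ≢ f) (b : x ≢ y) → VCell Γ n
    oldCell x p a b = x , isCell-transport Γ′ Γ x (lookup-old a b) p

    H-src : ∀ {n} (c : VCell Γ′ (suc n)) → H (src (V d′) c) ≡ src Y (H c)
    H-src (x , p) with which x
    ... | is-f refl =
      let zc′ = isCell-cast Γ′ srcName-f (srcOK x d′ p) in
      trans (H-at-irr _ _ srcName-f (which _) (is-old (old≢f z∈Var) (old≢y z∈Var)) _ zc′)
            (E-src (isCell-dim Γ′ f lookup-f p) (oldCell z zc′ (old≢f z∈Var) (old≢y z∈Var)) refl)
    ... | is-y refl =
      let sv : srcName Γ z ∈ Var Γ
          sv = srcName-z∈Var Ty₀ lz (isCell-dim Γ′ y lookup-y p)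
          q′ = isCell-cast Γ′ (srcName-y (isCell-dim Γ′ y lookup-y p)) (srcOK x d′ p) in
      trans (H-at-irr _ _ (srcName-y (isCell-dim Γ′ y lookup-y p)) (which _) (is-old (old≢f sv) (old≢y sv)) _ q′)
            (tgtE-src (isCell-dim Γ′ y lookup-y p) (oldCell _ q′ (old≢f sv) (old≢y sv)) refl)
    ... | is-old a b =
      let c₀ = oldCell x p a b
          sv = cell∈Var Γ (src (V d) c₀)
          e = cong (sM x) (lookup-old a b)
          q′ = isCell-cast Γ′ e (srcOK x d′ p) in
      trans (H-at-irr _ _ e (which _) (is-old (old≢f sv) (old≢y sv)) _ q′)
            (trans (cong (fun h) (cellEq {Γ} refl)) (fun-src h c₀))

    H-tgt : ∀ {n} (c : VCell Γ′ (suc n)) → H (tgt (V d′) c) ≡ tgt Y (H c)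
    H-tgt (x , p) with which x
    ... | is-f refl =
      let q′ = isCell-cast Γ′ tgtName-f (tgtOK x d′ p) in
      trans (H-at-irr _ _ tgtName-f (which _) (is-y refl) _ q′) (subst-tgt (isCell-dim Γ′ y lookup-y q′)
        (isCell-dim Γ′ f lookup-f p))
    ... | is-y refl =
      let sv : tgtName Γ z ∈ Var Γ
          sv = tgtName-z∈Var Ty₀ lz (isCell-dim Γ′ y lookup-y p)
          q′ = isCell-cast Γ′ (tgtName-y (isCell-dim Γ′ y lookup-y p)) (tgtOK x d′ p) in
      trans (H-at-irr _ _ (tgtName-y (isCell-dim Γ′ y lookup-y p)) (which _) (is-old (old≢f sv) (old≢y sv)) _ q′)
            (tgtE-tgt (isCell-dim Γ′ y lookup-y p) (oldCell _ q′ (old≢f sv) (old≢y sv)) refl)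
    ... | is-old a b =
      let c₀ = oldCell x p a b
          sv = cell∈Var Γ (tgt (V d) c₀)
          e = cong (tM x) (lookup-old a b)
          q′ = isCell-cast Γ′ e (tgtOK x d′ p) in
      trans (H-at-irr _ _ e (which _) (is-old (old≢f sv) (old≢y sv)) _ q′)
            (trans (cong (fun h) (cellEq {Γ} refl)) (fun-tgt h c₀))

    hom : GHom (V d′) Y
    hom = record { fun = H ; fun-src = H-src ; fun-tgt = H-tgt }

    f-cell = cellOf {Γ′} {f} lookup-f

    H-f : H f-cell ≡ E
    H-f = trans (H-name f (proj₂ f-cell) (is-f refl))
                (cong (λ e → subst (Cell Y) e E)
                      (≡-irrelevant (isCell-dim Γ′ f {suc (dim1 Ty₀)} lookup-f (proj₂ f-cell)) refl))


-- Canonical ps-contexts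

-- A ps-derivation in progress, with variables named by consecutive numerals: the context built so
-- far, the next fresh name, and the current judgement ctx ⊢ps focus ∶ focusTy.
record State : Set where
  constructor mkSt
  field
    ctx : Ctx
    fresh : ℕ
    focus : ℕ
    focusTy : Ty
open State public

initial : State
initial = mkSt (∅ ▸ 0 ∶ ⋆) 1 0 ⋆

pseStep : State → State
pseStep s = mkSt ((ctx s ▸ fresh s ∶ focusTy s) ▸ suc (fresh s) ∶ newTy)
                 (suc (suc (fresh s))) (suc (fresh s)) newTy
  where newTy = focus s ⟶[ focusTy s ] fresh s

pseⁿ : ℕ → State → State
pseⁿ zero s = s
pseⁿ (suc k) s = pseStep (pseⁿ k s)

-- On a focus of type ⋆ the rule pst does not apply; pstFocus then leaves it unchanged.
pstFocus : ℕ × Ty → ℕ × Ty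
pstFocus (z , ⋆) = z , ⋆
pstFocus (z , (a ⟶[ B ] b)) = b , B

pstFocusⁿ : ℕ → ℕ × Ty → ℕ × Ty
pstFocusⁿ zero p = p
pstFocusⁿ (suc a) p = pstFocus (pstFocusⁿ a p)

pstⁿ : ℕ → State → State
pstⁿ a s = mkSt (ctx s) (fresh s) (proj₁ newFocus) (proj₂ newFocus)
  where newFocus = pstFocusⁿ a (focus s , focusTy s)

WellFormed : State → Set
WellFormed s = (ctx s ⊢ps focus s ∶ focusTy s) × (∀ x → x ∈ Var (ctx s) → x < fresh s)

valid : ∀ {s} → WellFormed s → ctx s ⊢
valid inv = ps-ctx (proj₁ inv)

lookup-focus : ∀ {s} → WellFormed s → lookupTy (ctx s) (focus s) ≡ just (focusTy s)
lookup-focus inv = ps-lookup (proj₁ inv)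

focusCell : ∀ s → WellFormed s → VCell (ctx s) (dim1 (focusTy s))
focusCell s inv = cellOf {ctx s} {focus s} (lookup-focus inv)

initial-wf : WellFormed initial
initial-wf = pss , λ { x (here refl) → s≤s z≤n }

pse-wf : ∀ {s} → WellFormed s → WellFormed (pseStep s)
pse-wf {s} (p , fr) =
  pse p (λ m → <-irrefl refl (fr _ m)) (λ m → <-irrefl refl (<-trans (n<1+n _) (fr _ m))) (λ e → <-irrefl e (n<1+n _)) ,
  λ { x (here refl) → n<1+n _
    ; x (there (here refl)) → <-trans (n<1+n _) (n<1+n _)
    ; x (there (there m)) → <-trans (fr x m) (<-trans (n<1+n _) (n<1+n _)) }

pseⁿ-wf : ∀ k {s} → WellFormed s → WellFormed (pseⁿ k s)
pseⁿ-wf zero inv = inv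
pseⁿ-wf (suc k) inv = pse-wf (pseⁿ-wf k inv)

pst-ps : ∀ {Γ} z T → Γ ⊢ps z ∶ T → Γ ⊢ps proj₁ (pstFocus (z , T)) ∶ proj₂ (pstFocus (z , T))
pst-ps z ⋆ p = p
pst-ps z (a ⟶[ B ] b) p = pst p

pstⁿ-ps : ∀ {Γ} a z T → Γ ⊢ps z ∶ T → Γ ⊢ps proj₁ (pstFocusⁿ a (z , T)) ∶ proj₂ (pstFocusⁿ a (z , T))
pstⁿ-ps zero z T p = p
pstⁿ-ps (suc a) z T p = pst-ps _ _ (pstⁿ-ps a z T p)

pstⁿ-wf : ∀ a {s} → WellFormed s → WellFormed (pstⁿ a s)
pstⁿ-wf a {s} (p , fr) = pstⁿ-ps a (focus s) (focusTy s) p , fr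

dim-pstⁿ : ∀ a z T → dim1 (proj₂ (pstFocusⁿ a (z , T))) ≡ dim1 T ∸ a
dim-pstⁿ zero z T = refl
dim-pstⁿ (suc a) z T = trans (step (pstFocusⁿ a (z , T))) (trans
  (cong pred (dim-pstⁿ a z T)) (pred[m∸n]≡m∸[1+n] (dim1 T) a))
  where
  step : ∀ p → dim1 (proj₂ (pstFocus p)) ≡ pred (dim1 (proj₂ p))
  step (z , ⋆) = refl
  step (z , (a ⟶[ B ] b)) = refl

tgtNameⁿ : Ctx → ℕ → ℕ → ℕ
tgtNameⁿ Γ zero x = x
tgtNameⁿ Γ (suc a) x = tgtName Γ (tgtNameⁿ Γ a x)

focus-pstⁿ : ∀ a {Γ} z T → Γ ⊢ps z ∶ T → proj₁ (pstFocusⁿ a (z , T)) ≡ tgtNameⁿ Γ a z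
focus-pstⁿ zero z T p = refl
focus-pstⁿ (suc a) {Γ} z T p = trans (step (pstFocusⁿ a (z , T)) (pstⁿ-ps a z T p))
  (cong (tgtName Γ) (focus-pstⁿ a z T p))
  where
  step : ∀ q → Γ ⊢ps proj₁ q ∶ proj₂ q → proj₁ (pstFocus q) ≡ tgtName Γ (proj₁ q)
  step (z , ⋆) p with ps-typed p
  ... | _ , var d m rewrite memLookup d m = refl
  step (z , (a ⟶[ B ] b)) p with ps-typed p
  ... | _ , var d m rewrite memLookup d m = refl

-- k pse-steps from s glue to V s, along its iterated source, a disk of dimension dim (focusTy s) + k
-- whose top cell is the new focus: stage-generated and stage-extend are the two halves of this.
module PseBlock (s : State) (inv : WellFormed s) where
  stage : ℕ → State
  stage k = pseⁿ k s
  stage-wf : ∀ k → WellFormed (stage k)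
  stage-wf k = pseⁿ-wf k inv
  VStage : ℕ → GSet
  VStage k = V (valid (stage-wf k))
  topCell : ∀ k → VCell (ctx (stage k)) (dim1 (focusTy (stage k)))
  topCell k = focusCell (stage k) (stage-wf k)

  module PE (k : ℕ) =
    NewCell {ctx (stage k)} {focus (stage k)} {fresh (stage k)} {suc (fresh (stage k))} {focusTy (stage k)}
            (valid (stage-wf k)) (valid (stage-wf (suc k))) (lookup-focus (stage-wf k))

  ιⁿ : ∀ k → GHom (VStage 0) (VStage k)
  ιⁿ zero = idG
  ιⁿ (suc k) = PE.ι k ∘G ιⁿ k

  ιⁿ-name : ∀ k {n} (c : VCell (ctx s) n) → proj₁ (fun (ιⁿ k) c) ≡ proj₁ c
  ιⁿ-name zero c = refl
  ιⁿ-name (suc k) c = ιⁿ-name k c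

  src-topCell : ∀ k → src (VStage (suc k)) (topCell (suc k)) ≡ fun (PE.ι k) (topCell k)
  src-topCell k = cellEq {ctx (stage (suc k))} (cong (sM _) (PE.lookup-f k))

  faceAt-topCell-suc : ∀ k {n} (y : DCell (dim1 (focusTy (stage k))) n)
                     → faceAt (VStage (suc k)) (topCell (suc k)) (fun (incl false (n<1+n _)) y)
                       ≡ fun (PE.ι k) (faceAt (VStage k) (topCell k) y)
  faceAt-topCell-suc k y =
    trans (sym (faceAt-src (VStage (suc k)) (topCell (suc k)) y))
      (trans (cong (λ c → faceAt (VStage (suc k)) c y) (src-topCell k))
        (sym (faceAt-natural (PE.ι k) (topCell k) y)))

  top<′ : ∀ k → dim1 (focusTy s) <′ dim1 (focusTy (stage (suc k)))
  top<′ zero = ≤′-refl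
  top<′ (suc k) = ≤′-step (top<′ k)

  face-topCell : ∀ k → face (VStage (suc k)) (topCell (suc k)) (top<′ k) false ≡ fun (ιⁿ (suc k)) (topCell 0)
  face-topCell zero = src-topCell zero
  face-topCell (suc k) =
    trans (cong (λ c → face (VStage (suc (suc k))) c (top<′ k) false) (src-topCell (suc k)))
      (trans (sym (face-natural (PE.ι (suc k)) (topCell (suc k)) (top<′ k) false))
        (cong (fun (PE.ι (suc k))) (face-topCell k)))

  module SN (Y : GSet) where
    srcⁿ : ∀ k → Cell Y (dim1 (focusTy (stage k))) → Cell Y (dim1 (focusTy s))
    srcⁿ zero E = E
    srcⁿ (suc k) E = srcⁿ k (src Y E)

    srcⁿ-face : ∀ k (E : Cell Y (dim1 (focusTy (stage (suc k))))) → srcⁿ (suc k) E ≡ face Y E (top<′ k) false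
    srcⁿ-face zero E = refl
    srcⁿ-face (suc k) E = srcⁿ-face k (src Y E)

  base-in-top : ∀ k → Σ (DCell (dim1 (focusTy (stage k))) (dim1 (focusTy s))) λ y
                      → faceAt (VStage k) (topCell k) y ≡ fun (ιⁿ k) (topCell 0)
  base-in-top zero = top , refl
  base-in-top (suc k) with base-in-top k
  ... | y , e = fun (incl false (n<1+n _)) y , trans (faceAt-topCell-suc k y) (cong (fun (PE.ι k)) e)

  faceAt-top-subst : ∀ (X : GSet) {D n} (e : D ≡ n) (c : Cell X D) (x : Cell X n)
                   → subst (Cell X) e c ≡ x → faceAt X c (subst (DCell D) e top) ≡ x
  faceAt-top-subst X refl c x eq = eq

  stage-generated : ∀ k {n} (x : VCell (ctx (stage k)) n)
                  → (Σ (VCell (ctx s) n) λ c → fun (ιⁿ k) c ≡ x)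
                    ⊎ (Σ (DCell (dim1 (focusTy (stage k))) n) λ y → faceAt (VStage k) (topCell k) y ≡ x)
  stage-generated zero x = inj₁ (x , refl)
  stage-generated (suc k) {n} x with PE.classify k x
  ... | inj₁ (c′ , e) with stage-generated k c′
  ...   | inj₁ (c , e′) = inj₁ (c , trans (cong (fun (PE.ι k)) e′) e)
  ...   | inj₂ (y , e′) = inj₂ (fun (incl false (n<1+n _)) y ,
                               trans (faceAt-topCell-suc k y) (trans (cong (fun (PE.ι k)) e′) e))
  stage-generated (suc k) {n} x | inj₂ (inj₁ x≡f) =
    inj₂ (subst (DCell _) e top , faceAt-top-subst (VStage (suc k)) e (topCell (suc k)) x (is-top e x x≡f))
    where
    Γ′ = ctx (stage (suc k))
    e = isCell-dim Γ′ (proj₁ x) (trans (cong (lookupTy Γ′) x≡f) (PE.lookup-f k)) (proj₂ x)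
    is-top : ∀ {m} (e : dim1 (focusTy (stage (suc k))) ≡ m) (x : VCell Γ′ m)
           → proj₁ x ≡ suc (fresh (stage k)) → subst (VCell Γ′) e (topCell (suc k)) ≡ x
    is-top refl x x≡f = cellEq {Γ′} (sym x≡f)
  stage-generated (suc k) {n} x | inj₂ (inj₂ x≡y) = inj₂ (subst (DCell _) e (bd (n<1+n _) true) , is-tgt e x x≡y)
    where
    Γ′ = ctx (stage (suc k))
    e = isCell-dim Γ′ (proj₁ x) (trans (cong (lookupTy Γ′) x≡y) (PE.lookup-y k)) (proj₂ x)
    is-tgt : ∀ {m} (e : dim1 (focusTy (stage k)) ≡ m) (x : VCell Γ′ m) → proj₁ x ≡ fresh (stage k)
           → faceAt (VStage (suc k)) (topCell (suc k)) (subst (DCell _) e (bd (n<1+n _) true)) ≡ x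
    is-tgt refl x x≡y =
      trans (cong (λ q → face (VStage (suc k)) (topCell (suc k)) q true) (<′-irrelevant (<′-recompute _) ≤′-refl))
        (cellEq {Γ′} (trans (cong (tM _) (PE.lookup-f k)) (sym x≡y)))

  stage-extend : ∀ k (Y : GSet) (h : GHom (VStage 0) Y) (E : Cell Y (dim1 (focusTy (stage k))))
               → SN.srcⁿ Y k E ≡ fun h (topCell 0)
               → Σ (GHom (VStage k) Y) λ h′
                   → (∀ {n} (c : VCell (ctx s) n) → fun h′ (fun (ιⁿ k) c) ≡ fun h c) × (fun h′ (topCell k) ≡ E)
  stage-extend zero Y h E hE = h , (λ c → refl) , sym hE
  stage-extend (suc k) Y h E hE with stage-extend k Y h (src Y E) hE
  ... | hk , agree , topk =
    X.hom , (λ c → trans (X.H-old (fun (ιⁿ k) c)) (agree c)) ,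
    trans (cong X.H (cellEq {ctx (stage (suc k))} {c = topCell (suc k)} {c′ = X.f-cell} refl)) X.H-f
    where module X = PE.Extend k Y hk E (sym topk)


-- Canonical ps-contexts are globular sums

last-elim : ∀ {n} {P : Fin (suc n) → Set} → (∀ q → P (inject₁ q)) → P (fromℕ n) → ∀ p → P p
last-elim {zero} f a fzero = a
last-elim {suc n} f a fzero = f fzero
last-elim {suc n} {P} f a (fsuc p) = last-elim {n} {λ q → P (fsuc q)} (λ q → f (fsuc q)) a p

last-elim-inject₁ : ∀ {n} {P : Fin (suc n) → Set} f a (q : Fin n) → last-elim {n} {P} f a (inject₁ q) ≡ f q
last-elim-inject₁ {suc n} f a fzero = refl
last-elim-inject₁ {suc n} {P} f a (fsuc q) = last-elim-inject₁ {n} {λ q → P (fsuc q)} (λ q → f (fsuc q)) a q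

last-elim-fromℕ : ∀ {n} {P : Fin (suc n) → Set} f a → last-elim {n} {P} f a (fromℕ n) ≡ a
last-elim-fromℕ {zero} f a = refl
last-elim-fromℕ {suc n} {P} f a = last-elim-fromℕ {n} {λ q → P (fsuc q)} (λ q → f (fsuc q)) a

idV : ∀ {Γ} (d d′ : Γ ⊢) → GHom (V d) (V d′)
idV {Γ} d d′ = record { fun = λ c → c ; fun-src = λ c → cellEq {Γ} refl ; fun-tgt = λ c → cellEq {Γ} refl }

map-subst : ∀ {Γ} {d : Γ ⊢} {Y : GSet} (g : GHom (V d) Y) {m1 m2} (e : m1 ≡ m2) (c1 : VCell Γ m1) (c2 : VCell Γ m2)
       → proj₁ c1 ≡ proj₁ c2 → subst (Cell Y) e (fun g c1) ≡ fun g c2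
map-subst {Γ} g refl c1 c2 eq = cong (fun g) (cellEq {Γ} eq)

faceAt-subst : ∀ {Γ} (d : Γ ⊢) {D1 D2 m} (e : D1 ≡ D2) (c1 : VCell Γ D1) (c2 : VCell Γ D2) (y : DCell D1 m)
          → proj₁ c1 ≡ proj₁ c2 → faceAt (V d) c2 (subst (λ k → DCell k m) e y) ≡ faceAt (V d) c1 y
faceAt-subst {Γ} d refl c1 c2 y eq = cong (λ c → faceAt (V d) c y) (cellEq {Γ} (sym eq))

face-subst : ∀ (Y : GSet) {i Di j m′} (e1 : i ≡ Di) (e2 : j ≡ m′) (q : j <′ i) (q′ : m′ <′ Di) (c : Cell Y i) b
          → face Y (subst (Cell Y) e1 c) q′ b ≡ subst (Cell Y) e2 (face Y c q b)
face-subst Y refl refl q q′ c b = cong (λ r → face Y c r b) (<′-irrelevant q′ q)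

srcNameⁿ : Ctx → ℕ → ℕ → ℕ
srcNameⁿ Γ zero x = x
srcNameⁿ Γ (suc k) x = srcNameⁿ Γ k (srcName Γ x)

tgtNameⁿ-suc : ∀ Γ a x → tgtNameⁿ Γ (suc a) x ≡ tgtNameⁿ Γ a (tgtName Γ x)
tgtNameⁿ-suc Γ zero x = refl
tgtNameⁿ-suc Γ (suc a) x = cong (tgtName Γ) (tgtNameⁿ-suc Γ a x)

steps : ∀ {m n} → m <′ n → ℕ
steps ≤′-refl = 1
steps (≤′-step q) = suc (steps q)

steps+ : ∀ {m n} (q : m <′ n) → steps q + m ≡ n
steps+ ≤′-refl = refl
steps+ (≤′-step q) = cong suc (steps+ q)

steps≡∸ : ∀ {m n} (q : m <′ n) → steps q ≡ n ∸ m
steps≡∸ {m} {n} q = trans (sym (m+n∸n≡m (steps q) m)) (cong (_∸ m) (steps+ q))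

tgtⁿ : (X : GSet) → ∀ {i m} → Cell X i → m <′ i → Cell X m
tgtⁿ X c ≤′-refl = tgt X c
tgtⁿ X c (≤′-step q) = tgtⁿ X (tgt X c) q

tgtⁿ-src : ∀ (X : GSet) {i m} (c : Cell X (suc i)) (q : m <′ i) → tgtⁿ X (src X c) q ≡ tgtⁿ X (tgt X c) q
tgtⁿ-src X c ≤′-refl = tt X c
tgtⁿ-src X c (≤′-step q) = cong (λ z → tgtⁿ X z q) (tt X c)

face-true : ∀ (X : GSet) {i m} (c : Cell X i) (q : m <′ i) → face X c q true ≡ tgtⁿ X c q
face-true X c ≤′-refl = refl
face-true X c (≤′-step q) = trans (face-true X (src X c) q) (tgtⁿ-src X c q)

face-false-name : ∀ {Γ} (d : Γ ⊢) {i m} (c : VCell Γ i) (q : m <′ i)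
                → proj₁ (face (V d) c q false) ≡ srcNameⁿ Γ (steps q) (proj₁ c)
face-false-name d c ≤′-refl = refl
face-false-name d c (≤′-step q) = face-false-name d (src (V d) c) q

tgtⁿ-name : ∀ {Γ} (d : Γ ⊢) {i m} (c : VCell Γ i) (q : m <′ i)
          → proj₁ (tgtⁿ (V d) c q) ≡ tgtNameⁿ Γ (steps q) (proj₁ c)
tgtⁿ-name d c ≤′-refl = refl
tgtⁿ-name {Γ} d c (≤′-step q) =
  trans (tgtⁿ-name d (tgt (V d) c) q) (sym (tgtNameⁿ-suc Γ (steps q) (proj₁ c)))

dim-pseⁿ : ∀ k s → dim1 (focusTy (pseⁿ k s)) ≡ k + dim1 (focusTy s)
dim-pseⁿ zero s = refl
dim-pseⁿ (suc k) s = cong suc (dim-pseⁿ k s)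

diagram : (n : ℕ) (dI : Fin (suc n) → ℕ) (dJ : Fin n → ℕ)
        → (∀ p → dJ p < dI (inject₁ p)) → (∀ p → dJ p < dI (fsuc p)) → Diagram
diagram n dI dJ pL pR = record { len = n ; dimI = dI ; dimJ = dJ ; j<iL = pL ; j<iR = pR }

dropLast : ∀ n (dI : Fin (suc (suc n)) → ℕ) (dJ : Fin (suc n) → ℕ)
         → (∀ p → dJ p < dI (inject₁ p)) → (∀ p → dJ p < dI (fsuc p)) → Diagram
dropLast n dI dJ pL pR =
  diagram n (λ p → dI (inject₁ p)) (λ p → dJ (inject₁ p)) (λ p → pL (inject₁ p)) (λ p → pR (inject₁ p))

module AddDisk (n : ℕ) (dI : Fin (suc (suc n)) → ℕ) (dJ : Fin (suc n) → ℕ)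
  (pL : ∀ p → dJ p < dI (inject₁ p)) (pR : ∀ p → dJ p < dI (fsuc p))
  (sr : State) (ivr : WellFormed sr)
  (cfr : CellColimit (dropLast n dI dJ pL pR) (V (valid ivr)))
  (topr : proj₁ (CellColimit.cell cfr (fromℕ n)) ≡ focus sr)
  (dimr : dim1 (focusTy sr) ≡ dI (inject₁ (fromℕ n)))
  (b′ : ℕ) (eb : dI (fsuc (fromℕ n)) ∸ dJ (fromℕ n) ≡ suc b′)
  where
  𝒟 = diagram (suc n) dI dJ pL pR
  i′ = dI (inject₁ (fromℕ n))
  j = dJ (fromℕ n)
  i = dI (fsuc (fromℕ n))
  a = i′ ∸ j
  s1 = pstⁿ a sr
  inv1 = pstⁿ-wf a ivr
  module B = PseBlock s1 inv1
  b = suc b′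
  Γr = ctx sr
  Vr = V (valid ivr)
  Γ = ctx (B.stage b)
  X = B.VStage b
  Di = dim1 (focusTy (B.stage b))
  module CR = CellColimit cfr

  dimsj : dim1 (focusTy s1) ≡ j
  dimsj = trans (dim-pstⁿ a (focus sr) (focusTy sr)) (trans (cong (_∸ a) dimr) (m∸[m∸n]≡n (<⇒≤ (pL (fromℕ n)))))

  dimDi : Di ≡ i
  dimDi = trans (dim-pseⁿ b s1) (trans (cong (b +_) dimsj) (trans
    (cong (_+ j) (sym eb)) (m∸n+n≡m (<⇒≤ (pR (fromℕ n))))))

  reindex = idV (valid ivr) (valid inv1)
  reindex⁻¹ = idV (valid inv1) (valid ivr)
  J : GHom Vr X
  J = B.ιⁿ b ∘G reindex

  Jname : ∀ {m} (c : VCell Γr m) → proj₁ (fun J c) ≡ proj₁ c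
  Jname c = B.ιⁿ-name b c

  newTop : VCell Γ (dI (fromℕ (suc n)))
  newTop = focus (B.stage b) , isCell-intro Γ {focus (B.stage b)} (lookup-focus (B.stage-wf b)) dimDi

  cell : ∀ p → VCell Γ (dI p)
  cell = last-elim {suc n} {λ p → VCell Γ (dI p)} (λ q → fun J (CR.cell q)) newTop

  cell-old : ∀ q → cell (inject₁ q) ≡ fun J (CR.cell q)
  cell-old q = last-elim-inject₁ {suc n} {λ p → VCell Γ (dI p)} (λ q → fun J (CR.cell q)) newTop q

  cell-new : cell (fromℕ (suc n)) ≡ newTop
  cell-new = last-elim-fromℕ {suc n} {λ p → VCell Γ (dI p)} (λ q → fun J (CR.cell q)) newTop

  psr = proj₁ ivr

  tgt-face-is-focus : proj₁ (faceAt Vr (CR.cell (fromℕ n)) (bd (pL (fromℕ n)) true)) ≡ focus s1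
  tgt-face-is-focus = trans (cong proj₁ (face-true Vr (CR.cell (fromℕ n)) g))
       (trans (tgtⁿ-name (valid ivr) (CR.cell (fromℕ n)) g)
       (trans (cong₂ (tgtNameⁿ Γr) (steps≡∸ g) topr) (sym (focus-pstⁿ a (focus sr) (focusTy sr) psr))))
    where g = <′-recompute (pL (fromℕ n))

  src-face-is-focus : proj₁ (faceAt X newTop (bd (pR (fromℕ n)) false)) ≡ focus s1
  src-face-is-focus = trans (face-false-name (valid (B.stage-wf b)) newTop g)
       (trans (cong (λ k → srcNameⁿ Γ k (focus (B.stage b))) (trans (steps≡∸ g) (trans eb (sym (steps-top<′ b′)))))
       (trans (sym (face-false-name (valid (B.stage-wf b)) (B.topCell b) (B.top<′ b′)))
       (trans (cong proj₁ (B.face-topCell b′)) (B.ιⁿ-name b (B.topCell 0)))))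
    where
    g = <′-recompute (pR (fromℕ n))
    steps-top<′ : ∀ k → steps (B.top<′ k) ≡ suc k
    steps-top<′ zero = refl
    steps-top<′ (suc k) = cong suc (steps-top<′ k)

  glue : ∀ p → Glues X 𝒟 cell p
  glue = last-elim {n} {λ p → Glues X 𝒟 cell p} glue-old glue-new
    where
    glue-old : ∀ q → Glues X 𝒟 cell (inject₁ q)
    glue-old q = trans (cong (λ c → faceAt X c (bd (pL (inject₁ q)) true)) (cell-old (inject₁ q)))
             (trans (sym (faceAt-natural J (CR.cell (inject₁ q)) (bd (pL (inject₁ q)) true))) (trans
               (cong (fun J) (CR.glue q))
             (trans (faceAt-natural J (CR.cell (fsuc q)) (bd (pR (inject₁ q)) false))
               (cong (λ c → faceAt X c (bd (pR (inject₁ q)) false)) (sym (cell-old (fsuc q)))))))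
    glue-new : Glues X 𝒟 cell (fromℕ n)
    glue-new = trans (cong (λ c → faceAt X c (bd (pL (fromℕ n)) true)) (cell-old (fromℕ n)))
            (trans (sym (faceAt-natural J (CR.cell (fromℕ n)) (bd (pL (fromℕ n)) true)))
            (trans (cellEq {Γ} {c = fun J (faceAt Vr (CR.cell (fromℕ n)) (bd (pL (fromℕ n)) true))}
                               {c′ = faceAt X newTop (bd (pR (fromℕ n)) false)}
                      (trans (Jname _) (trans tgt-face-is-focus (sym src-face-is-focus))))
            (cong (λ c → faceAt X c (bd (pR (fromℕ n)) false)) (sym cell-new))))

  generate : ∀ m (x : Cell X m) → Σ (Fin (suc (suc n))) λ p → Σ (DCell (dI p) m) λ y → faceAt X (cell p) y ≡ x
  generate m x with B.stage-generated b x
  ... | inj₁ (c , e) =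
    let (q , y , e′) = CR.generate m c in
    inject₁ q , y , trans (cong (λ c → faceAt X c y) (cell-old q))
      (trans (sym (faceAt-natural J (CR.cell q) y)) (trans (cong (fun J) e′) e))
  ... | inj₂ (y , e) =
    fromℕ (suc n) , subst (λ k → DCell k m) dimDi y ,
    trans (cong (λ c → faceAt X c (subst (λ k → DCell k m) dimDi y)) cell-new)
      (trans (faceAt-subst (valid (B.stage-wf b)) dimDi (B.topCell b) newTop y refl) e)

  extend : ∀ (Y : GSet) (e : ∀ p → Cell Y (dI p)) → (∀ p → Glues Y 𝒟 e p) → Σ (GHom X Y) λ h → ∀ p
         → fun h (cell p) ≡ e p
  extend Y e ce = h′ , last-elim {suc n} {λ p → fun h′ (cell p) ≡ e p} h-old h-new
    where
    e-old : ∀ q → Cell Y (dI (inject₁ q))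
    e-old q = e (inject₁ q)
    hrp = CR.extend Y e-old (λ q → ce (inject₁ q))
    hR = proj₁ hrp
    hrEq = proj₂ hrp
    h0 = hR ∘G reindex⁻¹
    E : Cell Y Di
    E = subst (Cell Y) (sym dimDi) (e (fromℕ (suc n)))
    E-src-face : face Y E (B.top<′ b′) false ≡ fun h0 (B.topCell 0)
    E-src-face =
      trans (face-subst Y (sym dimDi) (sym dimsj) (<′-recompute (pR (fromℕ n))) (B.top<′ b′) (e (fromℕ (suc n))) false)
      (trans (cong (subst (Cell Y) (sym dimsj)) (sym (ce (fromℕ n))))
      (trans (cong (λ z → subst (Cell Y) (sym dimsj) (faceAt Y z (bd (pL (fromℕ n)) true))) (sym (hrEq (fromℕ n))))
      (trans (cong (subst (Cell Y) (sym dimsj)) (sym (faceAt-natural hR (CR.cell (fromℕ n)) _)))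
      (map-subst {Γr} {valid ivr} {Y} hR (sym dimsj) (faceAt Vr (CR.cell (fromℕ n)) (bd (pL (fromℕ n)) true))
                 (B.topCell 0) tgt-face-is-focus))))
    hE : B.SN.srcⁿ Y b E ≡ fun h0 (B.topCell 0)
    hE = trans (B.SN.srcⁿ-face Y b′ E) E-src-face
    ex = B.stage-extend b Y h0 E hE
    h′ = proj₁ ex
    agree = proj₁ (proj₂ ex)
    topEq = proj₂ (proj₂ ex)
    h-old : ∀ q → fun h′ (cell (inject₁ q)) ≡ e (inject₁ q)
    h-old q = trans (cong (fun h′) (cell-old q)) (trans (agree (CR.cell q)) (hrEq q))
    h-new : fun h′ (cell (fromℕ (suc n))) ≡ e (fromℕ (suc n))
    h-new = trans (cong (fun h′) cell-new)
            (trans (sym (map-subst {Γ} {valid (B.stage-wf b)} {Y} h′ dimDi (B.topCell b) newTop refl))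
            (trans (cong (subst (Cell Y) dimDi) topEq) (subst-subst-sym dimDi)))

  cellColimit : CellColimit 𝒟 X
  cellColimit = record { cell = cell ; glue = glue ; generate = generate ; extend = extend }

  cell-new-is-focus : proj₁ (CellColimit.cell cellColimit (fromℕ (suc n))) ≡ focus (B.stage b)
  cell-new-is-focus = cong proj₁ cell-new

Γ0 : Ctx
Γ0 = ∅ ▸ 0 ∶ ⋆

Γ0-dim : ∀ {m} x → T (isCellM m (lookupTy Γ0 x)) → 0 ≡ m
Γ0-dim x p with isCell-elim Γ0 x p
... | A , eq , dm with lookupTy⇒∶∈ {Γ0} {x} eq
... | here = dm
... | there ()

Γ0-name : ∀ {m} x → T (isCellM m (lookupTy Γ0 x)) → x ≡ 0
Γ0-name x p with isCell-elim Γ0 x p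
... | A , eq , dm with lookupTy⇒∶∈ {Γ0} {x} eq
... | here = refl
... | there ()

point-map : ∀ (d0 : Γ0 ⊢) (Y : GSet) → Cell Y 0 → GHom (V d0) Y
point-map d0 Y pt = record { fun = λ c → subst (Cell Y) (Γ0-dim (proj₁ c) (proj₂ c)) pt
                          ; fun-src = λ c → ⊥-elim (0≢s (Γ0-dim (proj₁ c) (proj₂ c)))
                          ; fun-tgt = λ c → ⊥-elim (0≢s (Γ0-dim (proj₁ c) (proj₂ c))) }
  where
  0≢s : ∀ {m} → 0 ≢ suc m
  0≢s ()

module OneDisk (dI : Fin 1 → ℕ) (dJ : Fin 0 → ℕ)
               (pL : ∀ p → dJ p < dI (inject₁ p)) (pR : ∀ p → dJ p < dI (fsuc p)) where
  𝒟 = diagram 0 dI dJ pL pR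
  i = dI fzero
  module B = PseBlock initial initial-wf
  Γ = ctx (B.stage i)
  X = B.VStage i
  Di = dim1 (focusTy (B.stage i))

  dimDi : Di ≡ i
  dimDi = trans (dim-pseⁿ i initial) (+-identityʳ i)

  newTop : VCell Γ i
  newTop = focus (B.stage i) , isCell-intro Γ {focus (B.stage i)} (lookup-focus (B.stage-wf i)) dimDi

  cell : ∀ p → VCell Γ (dI p)
  cell fzero = newTop

  base-face : ∀ {m} (e : 0 ≡ m) (c : VCell Γ0 m) → subst (VCell Γ0) e (B.topCell 0) ≡ c → (x : VCell Γ m)
            → fun (B.ιⁿ i) c ≡ x
         → Σ (DCell i m) λ y → faceAt X newTop y ≡ x
  base-face refl c ec′ x ex =
    let (y0 , e0) = B.base-in-top i in
    subst (λ k → DCell k 0) dimDi y0 ,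
    trans (faceAt-subst (valid (B.stage-wf i)) dimDi (B.topCell i) newTop y0 refl) (trans e0 (trans
      (cong (fun (B.ιⁿ i)) ec′) ex))

  generate : ∀ m (x : Cell X m) → Σ (Fin 1) λ p → Σ (DCell (dI p) m) λ y → faceAt X (cell p) y ≡ x
  generate m x with B.stage-generated i x
  ... | inj₁ (c , e) =
    let e0 = Γ0-dim (proj₁ c) (proj₂ c) in
    fzero , base-face e0 c (is-base e0 c (sym (Γ0-name (proj₁ c) (proj₂ c)))) x e
    where
    is-base : ∀ {m} (e0 : 0 ≡ m) (c : VCell Γ0 m) → 0 ≡ proj₁ c → subst (VCell Γ0) e0 (B.topCell 0) ≡ c
    is-base refl c eq = cellEq {Γ0} eq
  ... | inj₂ (y , e) =
    fzero , subst (λ k → DCell k m) dimDi y , trans (faceAt-subst (valid (B.stage-wf i)) dimDi (B.topCell i)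
      newTop y refl) e

  extend : ∀ (Y : GSet) (e : ∀ p → Cell Y (dI p)) → (∀ p → Glues Y 𝒟 e p) → Σ (GHom X Y) λ h → ∀ p
         → fun h (cell p) ≡ e p
  extend Y e _ = h′ , λ { fzero → h-top }
    where
    E : Cell Y Di
    E = subst (Cell Y) (sym dimDi) (e fzero)
    pt = B.SN.srcⁿ Y i E
    h0 = point-map (valid initial-wf) Y pt
    hE : pt ≡ fun h0 (B.topCell 0)
    hE = cong (λ q → subst (Cell Y) q pt) (≡-irrelevant refl (Γ0-dim 0 (proj₂ (B.topCell 0))))
    ex = B.stage-extend i Y h0 E hE
    h′ = proj₁ ex
    topEq = proj₂ (proj₂ ex)
    h-top : fun h′ newTop ≡ e fzero
    h-top = trans (sym (map-subst {Γ} {valid (B.stage-wf i)} {Y} h′ dimDi (B.topCell i) newTop refl))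
            (trans (cong (subst (Cell Y) dimDi) topEq) (subst-subst-sym dimDi))

  cellColimit : CellColimit 𝒟 X
  cellColimit = record { cell = cell ; glue = λ () ; generate = generate ; extend = extend }

-- Shape i records the dimensions (i₀ ; j₁ , i₁ ; … ; jₙ , iₙ = i) of a globular sum; its canonical
-- ps-context adds each disk by pst-steps down to dimension jₖ followed by pse-steps up to iₖ.
data Shape : ℕ → Set where
  one : (i : ℕ) → Shape i
  snoc : ∀ {i′} → Shape i′ → (j i : ℕ) → Shape i

canonical : ∀ {i} → Shape i → State
canonical (one i) = pseⁿ i initial
canonical (snoc {i′} l j i) = pseⁿ (i ∸ j) (pstⁿ (i′ ∸ j) (canonical l))

ValidShape : ∀ {i} → Shape i → Set
ValidShape (one i) = ⊤
ValidShape (snoc {i′} l j i) = ValidShape l × j < i′ × j < i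

canonical-wf : ∀ {i} (l : Shape i) → ValidShape l → WellFormed (canonical l)
canonical-wf (one i) _ = pseⁿ-wf i initial-wf
canonical-wf (snoc {i′} l j i) (v , _ , _) = pseⁿ-wf (i ∸ j) (pstⁿ-wf (i′ ∸ j) (canonical-wf l v))

dim-canonical : ∀ {i} (l : Shape i) → ValidShape l → dim1 (focusTy (canonical l)) ≡ i
dim-canonical (one i) _ = trans (dim-pseⁿ i initial) (+-identityʳ i)
dim-canonical (snoc {i′} l j i) (v , ji′ , ji) =
  trans (dim-pseⁿ (i ∸ j) _) (trans (cong ((i ∸ j) +_) (trans (dim-pstⁿ (i′ ∸ j) _ _) (trans
    (cong (_∸ (i′ ∸ j)) (dim-canonical l v)) (m∸[m∸n]≡n (<⇒≤ ji′)))))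
        (m∸n+n≡m (<⇒≤ ji)))

shapeOf : (n : ℕ) (dI : Fin (suc n) → ℕ) (dJ : Fin n → ℕ) → Shape (dI (fromℕ n))
shapeOf zero dI dJ = one (dI fzero)
shapeOf (suc n) dI dJ =
  snoc (shapeOf n (λ p → dI (inject₁ p)) (λ p → dJ (inject₁ p))) (dJ (fromℕ n)) (dI (fsuc (fromℕ n)))

shapeOf-valid : ∀ n (dI : Fin (suc n) → ℕ) (dJ : Fin n → ℕ)
              → (∀ p → dJ p < dI (inject₁ p)) → (∀ p → dJ p < dI (fsuc p)) → ValidShape (shapeOf n dI dJ)
shapeOf-valid zero dI dJ pL pR = _
shapeOf-valid (suc n) dI dJ pL pR =
  shapeOf-valid n _ _ (λ p → pL (inject₁ p)) (λ p → pR (inject₁ p)) , pL (fromℕ n) , pR (fromℕ n)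

CanonicalColimit : ∀ n (dI : Fin (suc n) → ℕ) (dJ : Fin n → ℕ)
                   (pL : ∀ p → dJ p < dI (inject₁ p)) (pR : ∀ p → dJ p < dI (fsuc p)) → Set₁
CanonicalColimit n dI dJ pL pR =
  Σ (CellColimit (diagram n dI dJ pL pR) (V (valid (canonical-wf (shapeOf n dI dJ) (shapeOf-valid n dI dJ pL pR)))))
    λ cf → proj₁ (CellColimit.cell cf (fromℕ n)) ≡ focus (canonical (shapeOf n dI dJ))

canonical-colimit : ∀ n dI dJ pL pR → CanonicalColimit n dI dJ pL pR
canonical-colimit zero dI dJ pL pR = OneDisk.cellColimit dI dJ pL pR , refl
canonical-colimit (suc n) dI dJ pL pR = add-disk (i ∸ j) (+-∸-assoc 1 (pR (fromℕ n)))
  where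
  dIr = λ p → dI (inject₁ p)
  dJr = λ p → dJ (inject₁ p)
  pLr = λ p → pL (inject₁ p)
  pRr = λ p → pR (inject₁ p)
  i′ = dI (inject₁ (fromℕ n))
  j = dJ (fromℕ n)
  i = dI (fsuc (fromℕ n))
  lr = shapeOf n dIr dJr
  vr = shapeOf-valid n dIr dJr pLr pRr
  sr = canonical lr
  ivr = canonical-wf lr vr
  IH = canonical-colimit n dIr dJr pLr pRr
  b′ = i ∸ suc j
  add-disk : ∀ b → b ≡ suc b′ →
    Σ (CellColimit (diagram (suc n) dI dJ pL pR) (V (valid (pseⁿ-wf b (pstⁿ-wf (i′ ∸ j) ivr))))) λ cf
      → proj₁ (CellColimit.cell cf (fromℕ (suc n))) ≡ focus (pseⁿ b (pstⁿ (i′ ∸ j) sr))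
  add-disk .(suc b′) refl =
    let module S = AddDisk n dI dJ pL pR sr ivr (proj₁ IH) (proj₂ IH) (dim-canonical lr vr)
                           b′ (+-∸-assoc 1 (pR (fromℕ n))) in
    S.cellColimit , S.cell-new-is-focus

Canonical : Diagram → State
Canonical 𝒟 = canonical (shapeOf (len 𝒟) (dimI 𝒟) (dimJ 𝒟))

Canonical-wf : ∀ 𝒟 → WellFormed (Canonical 𝒟)
Canonical-wf 𝒟 = canonical-wf _ (shapeOf-valid (len 𝒟) (dimI 𝒟) (dimJ 𝒟) (j<iL 𝒟) (j<iR 𝒟))

V-Canonical : Diagram → GSet
V-Canonical 𝒟 = V (valid (Canonical-wf 𝒟))

V-Canonical-isColimit : ∀ 𝒟 → Σ (Cocone 𝒟 (V-Canonical 𝒟)) IsColimit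
V-Canonical-isColimit 𝒟 =
  CellColimit⇒IsColimit (proj₁ (canonical-colimit (len 𝒟) (dimI 𝒟) (dimJ 𝒟) (j<iL 𝒟) (j<iR 𝒟)))


-- Every ps-context is a renamed canonical context

renT-cong : ∀ {Γ A} (ρ ρ′ : ℕ → ℕ) → Γ ⊢ty A → (∀ v → v ∈ Var Γ → ρ v ≡ ρ′ v) → renT ρ A ≡ renT ρ′ A
renT-cong ρ ρ′ (star _) ag = refl
renT-cong ρ ρ′ (arr A (var _ m) (var _ m′)) ag = ⟶-cong (ag _ (memVar m)) (renT-cong ρ ρ′ A ag) (ag _ (memVar m′))

renC-cong : ∀ {Γ} (ρ ρ′ : ℕ → ℕ) → Γ ⊢ → (∀ v → v ∈ Var Γ → ρ v ≡ ρ′ v) → renC ρ Γ ≡ renC ρ′ Γ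
renC-cong ρ ρ′ ec ag = refl
renC-cong {Γ ▸ x ∶ A} ρ ρ′ d ag =
  trans (cong₂ (λ G B → G ▸ ρ x ∶ B) (renC-cong ρ ρ′ (ext-valid d) (λ v m → ag v (there m))) (renT-cong ρ ρ′
    (ext-ty d) (λ v m → ag v (there m))))
        (cong (λ w → renC ρ′ Γ ▸ w ∶ renT ρ′ A) (ag x (here refl)))

Var-renC : ∀ ρ Γ {v} → v ∈ Var Γ → ρ v ∈ Var (renC ρ Γ)
Var-renC ρ (Γ ▸ x ∶ A) (here refl) = here refl
Var-renC ρ (Γ ▸ x ∶ A) (there m) = there (Var-renC ρ Γ m)

-- Up to an injective renaming, every ps-judgement is reached from a canonical context by pst-steps.
Simulated : Ctx → ℕ → Ty → Set
Simulated Γ z T =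
  Σ ℕ λ i → Σ (Shape i) λ l → ValidShape l × Σ ℕ λ a → a ≤ i × Σ (ℕ → ℕ) λ ρ → InjOn ρ (Var Γ)
  × (ctx (pstⁿ a (canonical l)) ≡ renC ρ Γ × focus (pstⁿ a (canonical l)) ≡ ρ z
     × focusTy (pstⁿ a (canonical l)) ≡ renT ρ T)

module PseSimulation {Γ x A y f} (s : State) (inv : WellFormed s) (ρ : ℕ → ℕ) (inj : InjOn ρ (Var Γ))
  (ec : ctx s ≡ renC ρ Γ) (ef : focus s ≡ ρ x) (et : focusTy s ≡ renT ρ A)
  (px : Γ ⊢ps x ∶ A) (y∉Γ : y ∉ Var Γ) (f∉Γ : f ∉ Var Γ) (y≢f : y ≢ f) where
  N = fresh s
  ρ′ : ℕ → ℕ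
  ρ′ v with v ≟ f
  ... | yes _ = suc N
  ... | no _ with v ≟ y
  ... | yes _ = N
  ... | no _ = ρ v

  ρ′f : ρ′ f ≡ suc N
  ρ′f with f ≟ f
  ... | yes _ = refl
  ... | no ne = ⊥-elim (ne refl)
  ρ′y : ρ′ y ≡ N
  ρ′y with y ≟ f
  ... | yes e = ⊥-elim (y≢f e)
  ... | no _ with y ≟ y
  ... | yes _ = refl
  ... | no ne = ⊥-elim (ne refl)
  ρ′o : ∀ v → v ≢ f → v ≢ y → ρ′ v ≡ ρ v
  ρ′o v a b with v ≟ f
  ... | yes e = ⊥-elim (a e)
  ... | no _ with v ≟ y
  ... | yes e = ⊥-elim (b e)
  ... | no _ = refl

  ⊢A = proj₁ (ps-typed px)
  ⊢Γ = ctxOf ⊢A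
  x∈Γ : x ∈ Var Γ
  x∈Γ with proj₂ (ps-typed px)
  ... | var _ m = memVar m

  agree : ∀ v → v ∈ Var Γ → ρ v ≡ ρ′ v
  agree v m = sym (ρ′o v (λ { refl → f∉Γ m }) (λ { refl → y∉Γ m }))

  ρ<fresh : ∀ v → v ∈ Var Γ → ρ v < N
  ρ<fresh v m = proj₂ inv (ρ v) (subst (λ G → ρ v ∈ Var G) (sym ec) (Var-renC ρ Γ m))

  Γ′ = (Γ ▸ y ∶ A) ▸ f ∶ (x ⟶[ A ] y)

  inj′ : InjOn ρ′ (Var Γ′)
  inj′ {u} {v} mu mv e = ρ′-injective mu mv e
    where
    ρ′-injective : ∀ {u v} → u ∈ f ∷ y ∷ Var Γ → v ∈ f ∷ y ∷ Var Γ → ρ′ u ≡ ρ′ v → u ≡ v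
    ρ′-injective (here refl) (here refl) e = refl
    ρ′-injective (here refl) (there (here refl)) e = ⊥-elim (<-irrefl (trans (sym ρ′y) (trans (sym e) ρ′f)) (n<1+n N))
    ρ′-injective (here refl) (there (there m)) e = ⊥-elim (<-irrefl (trans
      (trans (agree _ m) (sym e)) ρ′f) (<-trans (ρ<fresh _ m) (n<1+n N)))
    ρ′-injective (there (here refl)) (here refl) e = ⊥-elim (<-irrefl (trans (sym ρ′y) (trans e ρ′f)) (n<1+n N))
    ρ′-injective (there (here refl)) (there (here refl)) e = refl
    ρ′-injective (there (here refl)) (there (there m)) e = ⊥-elim (<-irrefl (trans
      (trans (agree _ m) (sym e)) ρ′y) (ρ<fresh _ m))
    ρ′-injective (there (there m)) (here refl) e = ⊥-elim (<-irrefl (trans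
      (trans (agree _ m) e) ρ′f) (<-trans (ρ<fresh _ m) (n<1+n N)))
    ρ′-injective (there (there m)) (there (here refl)) e = ⊥-elim (<-irrefl (trans
      (trans (agree _ m) e) ρ′y) (ρ<fresh _ m))
    ρ′-injective (there (there m)) (there (there m′)) e = inj m m′ (trans (agree _ m) (trans e (sym (agree _ m′))))

  eA : renT ρ A ≡ renT ρ′ A
  eA = renT-cong ρ ρ′ ⊢A agree
  eΓ : renC ρ Γ ≡ renC ρ′ Γ
  eΓ = renC-cong ρ ρ′ ⊢Γ agree
  ex : ρ x ≡ ρ′ x
  ex = agree x x∈Γ

  ctx-pse : ctx (pseStep s) ≡ ((renC ρ′ Γ ▸ N ∶ renT ρ′ A) ▸ suc N ∶ (ρ′ x ⟶[ renT ρ′ A ] N))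
  ctx-pse = cong₂ (λ G T → G ▸ suc N ∶ T)
            (cong₂ (λ G T → G ▸ N ∶ T) (trans ec eΓ) (trans et eA))
            (cong₂ (λ p T → p ⟶[ T ] N) (trans ef ex) (trans et eA))
  ec′ : ctx (pseStep s) ≡ renC ρ′ Γ′
  ec′ = trans ctx-pse (cong₂ (λ u w → (renC ρ′ Γ ▸ u ∶ renT ρ′ A) ▸ w ∶ (ρ′ x ⟶[ renT ρ′ A ] u)) (sym ρ′y) (sym ρ′f))
  ef′ : focus (pseStep s) ≡ ρ′ f
  ef′ = sym ρ′f
  et′ : focusTy (pseStep s) ≡ renT ρ′ (x ⟶[ A ] y)
  et′ = ⟶-cong (trans ef ex) (trans et eA) (sym ρ′y)

pstFocus-arrow : ∀ p {a B b} → proj₂ p ≡ (a ⟶[ B ] b) → pstFocus p ≡ (b , B)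
pstFocus-arrow (z , .(_ ⟶[ _ ] _)) refl = refl

bump : ∀ {i} → Shape i → Shape (suc i)
bump (one i) = one (suc i)
bump (snoc l j i) = snoc l j (suc i)

bump-valid : ∀ {i} (l : Shape i) → ValidShape l → ValidShape (bump l)
bump-valid (one i) v = _
bump-valid (snoc l j i) (v , jl , ji) = v , jl , <-trans ji (n<1+n i)

canonical-bump : ∀ {i} (l : Shape i) → ValidShape l → canonical (bump l) ≡ pseStep (canonical l)
canonical-bump (one i) v = refl
canonical-bump (snoc {i′} l j i) (v , jl , ji) =
  cong (λ k → pseⁿ k (pstⁿ (i′ ∸ j) (canonical l))) (+-∸-assoc 1 (<⇒≤ ji))

simulate : ∀ {Γ z T} → Γ ⊢ps z ∶ T → Simulated Γ z T
simulate (pss {x}) = 0 , one 0 , _ , 0 , z≤n , (λ _ → 0) , (λ { (here refl) (here refl) _ → refl }) , refl , refl , refl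
simulate {Γ} (pst {f = f} {x = x} {y = y} {A = A} p) with simulate p
... | i , l , v , a , a≤i , ρ , inj , ecx , ef , et =
  let s = pstⁿ a (canonical l)
      e1 = pstFocus-arrow (focus s , focusTy s) et
      dimS : dim1 (focusTy s) ≡ i ∸ a
      dimS = trans (dim-pstⁿ a _ _) (cong (_∸ a) (dim-canonical l v))
      pos : 0 < i ∸ a
      pos = subst (0 <_) dimS (subst (λ T → 0 < dim1 T) (sym et) (s≤s z≤n))
  in i , l , v , suc a , m∸n≢0⇒n<m (n>0⇒n≢0 pos) , ρ , inj , ecx , cong proj₁ e1 , cong proj₂ e1
simulate (pse {Γ} {x} {A} {y} {f} p y∉Γ f∉Γ y≢f) with simulate p
... | i , l , v , zero , a≤i , ρ , inj , ecx , ef , et =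
  let module P = PseSimulation {Γ} {x} {A} {y} {f} (canonical l) (canonical-wf l v) ρ inj ecx ef et p y∉Γ f∉Γ y≢f
      eB = canonical-bump l v
  in suc i , bump l , bump-valid l v , 0 , z≤n , P.ρ′ , P.inj′ ,
     trans (cong ctx eB) P.ec′ , trans (cong focus eB) P.ef′ , trans (cong focusTy eB) P.et′
... | i , l , v , suc a , a≤i , ρ , inj , ecx , ef , et =
  let s = pstⁿ (suc a) (canonical l)
      module P = PseSimulation {Γ} {x} {A} {y} {f} s (pstⁿ-wf (suc a) (canonical-wf l v)) ρ inj ecx ef et p y∉Γ f∉Γ y≢f
      j = i ∸ suc a
      l′ = snoc l j (suc j)
      eB : canonical l′ ≡ pseStep s
      eB = cong₂ (λ k b → pseⁿ k (pstⁿ b (canonical l))) (m+n∸n≡m 1 j) (m∸[m∸n]≡n a≤i)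
  in suc j , l′ , (v , ∸-monoʳ-< (s≤s z≤n) a≤i , n<1+n j) , 0 , z≤n , P.ρ′ , P.inj′ ,
     trans (cong ctx eB) P.ec′ , trans (cong focus eB) P.ef′ , trans (cong focusTy eB) P.et′

ps⇒canonical : ∀ {Γ} → Γ ⊢ps → Σ ℕ λ i → Σ (Shape i) λ l → ValidShape l × Σ (ℕ → ℕ) λ ρ
             → InjOn ρ (Var Γ) × ctx (canonical l) ≡ renC ρ Γ
ps⇒canonical (psc p) with simulate p
... | i , l , v , a , _ , ρ , inj , ecx , _ , _ = i , l , v , ρ , inj , ecx

canonical-cong : ∀ n (f f′ : Fin (suc n) → ℕ) (g g′ : Fin n → ℕ) → (∀ p → f p ≡ f′ p) → (∀ p → g p ≡ g′ p)
       → canonical (shapeOf n f g) ≡ canonical (shapeOf n f′ g′)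
canonical-cong zero f f′ g g′ ef eg = cong (λ k → pseⁿ k initial) (ef fzero)
canonical-cong (suc n) f f′ g g′ ef eg =
  cong₂ (λ k X → pseⁿ k X) (cong₂ _∸_ (ef _) (eg _))
    (cong₂ (λ k X → pstⁿ k X)
      (cong₂ _∸_ (ef _) (eg _)) (canonical-cong n _ _ _ _ (λ p → ef (inject₁ p)) (λ p → eg (inject₁ p))))

ShapeDiagram : ∀ {i} → Shape i → Set
ShapeDiagram {i} l = Σ ℕ λ n → Σ (Fin (suc n) → ℕ) λ dI → Σ (Fin n → ℕ) λ dJ → Σ (∀ p → dJ p < dI (inject₁ p)) λ pL →
  Σ (∀ p → dJ p < dI (fsuc p)) λ pR → canonical (shapeOf n dI dJ) ≡ canonical l × dI (fromℕ n) ≡ i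

shape-diagram : ∀ {i} (l : Shape i) → ValidShape l → ShapeDiagram l
shape-diagram (one i) _ = 0 , (λ _ → i) , (λ ()) , (λ ()) , (λ ()) , refl , refl
shape-diagram (snoc {i′} l j i) (v , jl , ji) with shape-diagram l v
... | n , dI , dJ , pL , pR , eC , eI = suc n , dI′ , dJ′ , pL′ , pR′ , eC′ , last-elim-fromℕ {suc n} {λ _ → ℕ} dI i
  where
  dI′ : Fin (suc (suc n)) → ℕ
  dI′ = last-elim {suc n} {λ _ → ℕ} dI i
  dJ′ : Fin (suc n) → ℕ
  dJ′ = last-elim {n} {λ _ → ℕ} dJ j
  eIi : ∀ q → dI′ (inject₁ q) ≡ dI q
  eIi q = last-elim-inject₁ {suc n} {λ _ → ℕ} dI i q
  eJi : ∀ q → dJ′ (inject₁ q) ≡ dJ q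
  eJi q = last-elim-inject₁ {n} {λ _ → ℕ} dJ j q
  eJl : dJ′ (fromℕ n) ≡ j
  eJl = last-elim-fromℕ {n} {λ _ → ℕ} dJ j
  eIl : dI′ (fromℕ (suc n)) ≡ i
  eIl = last-elim-fromℕ {suc n} {λ _ → ℕ} dI i
  pL′ : ∀ p → dJ′ p < dI′ (inject₁ p)
  pL′ = last-elim {n} {λ p → dJ′ p < dI′ (inject₁ p)}
          (λ q → subst₂ _<_ (sym (eJi q)) (sym (eIi (inject₁ q))) (pL q))
          (subst₂ _<_ (sym eJl) (sym (trans (eIi (fromℕ n)) eI)) jl)
  pR′ : ∀ p → dJ′ p < dI′ (fsuc p)
  pR′ = last-elim {n} {λ p → dJ′ p < dI′ (fsuc p)}
          (λ q → subst₂ _<_ (sym (eJi q)) (sym (eIi (fsuc q))) (pR q))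
          (subst₂ _<_ (sym eJl) (sym eIl) ji)
  eC′ : canonical (shapeOf (suc n) dI′ dJ′) ≡ canonical (snoc l j i)
  eC′ = cong₂ (λ k X → pseⁿ k X) (cong₂ _∸_ eIl eJl)
          (cong₂ (λ k X → pstⁿ k X) (cong₂ _∸_ (trans (eIi (fromℕ n)) eI) eJl)
            (trans (canonical-cong n _ _ _ _ eIi eJi) eC))

ps⇒Canonical : ∀ {Γ} → Γ ⊢ps → Σ Diagram λ 𝒟 → Σ (ℕ → ℕ) λ ρ → InjOn ρ (Var Γ) × ctx (Canonical 𝒟) ≡ renC ρ Γ
ps⇒Canonical ps with ps⇒canonical ps
... | i , l , v , ρ , ρ-injective , Γ≡ρ with shape-diagram l v
... | n , dI , dJ , pL , pR , eq , _ = diagram n dI dJ pL pR , ρ , ρ-injective , trans (cong ctx eq) Γ≡ρ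


-- Isomorphic ps-contexts are α-equivalent

data Chain (Γ : Ctx) : ℕ → ℕ → Set where
  ch0 : ∀ {c} → Chain Γ c c
  chS : ∀ {c a B b e} → lookupTy Γ c ≡ just (a ⟶[ B ] b) → Chain Γ b e → Chain Γ c e

IsSrc : Ctx → ℕ → Set
IsSrc Γ e = Σ ℕ λ d → Σ Ty λ B → Σ ℕ λ b → lookupTy Γ d ≡ just (e ⟶[ B ] b)

IsTgt : Ctx → ℕ → Set
IsTgt Γ c = Σ ℕ λ d → Σ ℕ λ a → Σ Ty λ B → lookupTy Γ d ≡ just (a ⟶[ B ] c)

-- The variable added by the last pse-step is the only variable that is not a target and from which
-- iterated targets never reach a source (last-f, last-unique).
Last : Ctx → ℕ → Set
Last Γ c = c ∈ Var Γ × ¬ IsTgt Γ c × (∀ e → Chain Γ c e → ¬ IsSrc Γ e)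

module TypedMap (Γ Δ : Ctx) (k : ℕ → ℕ)
                (typed : ∀ v A → lookupTy Γ v ≡ just A → lookupTy Δ (k v) ≡ just (renT k A)) where
  chainMap : ∀ {c e} → Chain Γ c e → Chain Δ (k c) (k e)
  chainMap ch0 = ch0
  chainMap (chS eq ch) = chS (typed _ _ eq) (chainMap ch)
  srcMap : ∀ {e} → IsSrc Γ e → IsSrc Δ (k e)
  srcMap (d , B , b , eq) = k d , renT k B , k b , typed _ _ eq
  tgtMap : ∀ {c} → IsTgt Γ c → IsTgt Δ (k c)
  tgtMap (d , a , B , eq) = k d , k a , renT k B , typed _ _ eq

Last-transport : ∀ Γ Δ (g h : ℕ → ℕ)
  → (∀ v A → lookupTy Γ v ≡ just A → lookupTy Δ (g v) ≡ just (renT g A))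
  → (∀ v A → lookupTy Δ v ≡ just A → lookupTy Γ (h v) ≡ just (renT h A))
  → (∀ v → v ∈ Var Γ → h (g v) ≡ v)
  → ∀ c → Last Γ c → Last Δ (g c)
Last-transport Γ Δ g h gP hP hg c (mc , nt , ns) =
  let (A , lc) = ∈Var⇒lookupTy Γ mc
      module H = TypedMap Δ Γ h hP
  in lookupVar (gP c A lc) ,
     (λ it → nt (subst (IsTgt Γ) (hg c mc) (H.tgtMap it))) ,
     (λ e ch s → ns (h e) (subst (λ w → Chain Γ w (h e)) (hg c mc) (H.chainMap ch)) (H.srcMap s))

chain-dim : ∀ {Γ c e C} → Γ ⊢ → Chain Γ c e → lookupTy Γ c ≡ just C → Σ Ty λ E → lookupTy Γ e ≡ just E × dim1 E ≤ dim1 C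
chain-dim {C = C} d ch0 lc = C , lc , ≤-refl
chain-dim d (chS eq ch) lc with trans (sym lc) eq
... | refl with chain-dim d ch (proj₂ (key d eq))
... | E , le , dle = E , le , m≤n⇒m≤1+n dle

chain-same-dim : ∀ {Γ b e B E} → Γ ⊢ → Chain Γ b e → lookupTy Γ b ≡ just B → lookupTy Γ e ≡ just E
               → dim1 E ≡ dim1 B → e ≡ b
chain-same-dim d ch0 lb le eq = refl
chain-same-dim {B = B} d (chS eq ch) lb le dimEq with trans (sym lb) eq
... | refl with chain-dim d ch (proj₂ (key d eq))
... | E′ , le′ , dle with trans (sym le) le′
... | refl = ⊥-elim (<-irrefl dimEq (s≤s dle))

chain-snoc : ∀ {Γ c f a B y} → Chain Γ c f → lookupTy Γ f ≡ just (a ⟶[ B ] y) → Chain Γ c y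
chain-snoc ch0 lf = chS lf ch0
chain-snoc (chS eq ch) lf = chS eq (chain-snoc ch lf)

NoSrcAfter : Ctx → ℕ → Set
NoSrcAfter Γ z = ∀ e → Chain Γ z e → ¬ IsSrc Γ e

NoLoops : Ctx → Set
NoLoops Γ = ∀ v a B b → lookupTy Γ v ≡ just (a ⟶[ B ] b) → a ≢ b

ReachesFocus : Ctx → ℕ → Set
ReachesFocus Γ z = ∀ c → c ∈ Var Γ → ¬ IsTgt Γ c → (Σ ℕ λ e → Chain Γ c e × IsSrc Γ e) ⊎ Chain Γ c z

single-no-arrow : ∀ x d {a B b} → lookupTy (∅ ▸ x ∶ ⋆) d ≡ just (a ⟶[ B ] b) → ⊥
single-no-arrow x d eq with lookupTy⇒∶∈ {∅ ▸ x ∶ ⋆} {d} eq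
... | there ()

module PseInvariants {Γ x A y f} (p : Γ ⊢ps x ∶ A) (y∉Γ : y ∉ Var Γ) (f∉Γ : f ∉ Var Γ) (y≢f : y ≢ f) where
  Γ′ = (Γ ▸ y ∶ A) ▸ f ∶ (x ⟶[ A ] y)
  d = ps-ctx p
  d′ : Γ′ ⊢
  d′ = ps-ctx (pse p y∉Γ f∉Γ y≢f)
  lz = ps-lookup p
  module E = NewCell d d′ lz
  x∈Γ : x ∈ Var Γ
  x∈Γ = lookupVar lz

  lift-chain : ∀ {c e} → Chain Γ c e → Chain Γ′ c e
  lift-chain ch0 = ch0
  lift-chain (chS eq ch) = chS (trans (E.lookup-old-var (lookupVar eq)) eq) (lift-chain ch)

  lift-src : ∀ {e} → IsSrc Γ e → IsSrc Γ′ e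
  lift-src (dd , B , b , eq) = dd , B , b , trans (E.lookup-old-var (lookupVar eq)) eq

  lift-tgt : ∀ {c} → IsTgt Γ c → IsTgt Γ′ c
  lift-tgt (dd , a , B , eq) = dd , a , B , trans (E.lookup-old-var (lookupVar eq)) eq

  lower-chain : ∀ {b e} → Chain Γ′ b e → b ∈ Var Γ → Chain Γ b e
  lower-chain ch0 m = ch0
  lower-chain (chS eq ch) m =
    let eq′ = trans (sym (E.lookup-old-var m)) eq in
    chS eq′ (lower-chain ch (lookupVar (proj₂ (key d eq′))))

  data LookupCases (v : ℕ) (T : Ty) : Set where
    at-f : v ≡ f → T ≡ (x ⟶[ A ] y) → LookupCases v T
    at-y : v ≡ y → T ≡ A → LookupCases v T
    at-old : lookupTy Γ v ≡ just T → LookupCases v T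

  lookup-cases : ∀ v {T} → lookupTy Γ′ v ≡ just T → LookupCases v T
  lookup-cases v {T} eq with E.which v
  ... | E.is-f refl = at-f refl (just-injective (trans (sym eq) E.lookup-f))
  ... | E.is-y refl = at-y refl (just-injective (trans (sym eq) E.lookup-y))
  ... | E.is-old a b = at-old (trans (sym (E.lookup-old a b)) eq)

  src∈Var : ∀ {dd e B b} → lookupTy Γ dd ≡ just (e ⟶[ B ] b) → e ∈ Var Γ
  src∈Var eq = lookupVar (proj₁ (key d eq))

  y-not-src : ¬ IsSrc Γ′ y
  y-not-src (dd , B , b , eq) with lookup-cases dd eq
  ... | at-f _ te = y∉Γ (subst (_∈ Var Γ) (sym (proj₁ (⟶-injective te))) x∈Γ)
  ... | at-y _ te = y∉Γ (src∈Var (trans lz (cong just (sym te))))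
  ... | at-old eq′ = y∉Γ (src∈Var eq′)

  f-not-src : ¬ IsSrc Γ′ f
  f-not-src (dd , B , b , eq) with lookup-cases dd eq
  ... | at-f _ te = f∉Γ (subst (_∈ Var Γ) (sym (proj₁ (⟶-injective te))) x∈Γ)
  ... | at-y _ te = f∉Γ (src∈Var (trans lz (cong just (sym te))))
  ... | at-old eq′ = f∉Γ (src∈Var eq′)

  module _ (i1 : NoSrcAfter Γ x) (i2 : NoLoops Γ) where
    no-src-below-x : ∀ {a2 B2 b2 e} → lookupTy Γ x ≡ just (a2 ⟶[ B2 ] b2) → Chain Γ b2 e → ¬ IsSrc Γ′ e
    no-src-below-x {a2} {B2} {b2} {e} lz′ chΓ (dd , B3 , b3 , eq3) with lookup-cases dd eq3
    ... | at-f _ te3 with proj₁ (⟶-injective te3)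
    ...   | refl with chain-dim d chΓ (proj₂ (key d lz′))
    ...     | E , le , dle with trans (sym le) lz′
    ...       | refl = <-irrefl refl (s≤s dle)
    no-src-below-x {a2} {B2} {b2} {e} lz′ chΓ (dd , B3 , b3 , eq3) | at-y _ te3 with ⟶-injective
      (trans te3 (just-injective (trans (sym lz) lz′)))
    ... | refl , refl , refl = i2 x a2 B2 b2 lz′ (chain-same-dim d chΓ (proj₂ (key d lz′)) (proj₁ (key d lz′)) refl)
    no-src-below-x {a2} {B2} {b2} {e} lz′ chΓ (dd , B3 , b3 , eq3) | at-old eq′ = i1 e (chS lz′ chΓ) (dd , B3 , b3 , eq′)

    no-src-after-y : ∀ {e} → Chain Γ′ y e → ¬ IsSrc Γ′ e
    no-src-after-y ch0 s = y-not-src s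
    no-src-after-y (chS eq ch) s with lookup-cases y eq
    ... | at-f e1 _ = ⊥-elim (y≢f e1)
    ... | at-old eq′ = y∉Γ (lookupVar eq′)
    ... | at-y _ te2 =
      let lz′ = trans lz (cong just (sym te2)) in
      no-src-below-x lz′ (lower-chain ch (lookupVar (proj₂ (key d lz′)))) s

    noSrcAfter-f : NoSrcAfter Γ′ f
    noSrcAfter-f e ch0 s = f-not-src s
    noSrcAfter-f e (chS eq ch) s with lookup-cases f eq
    ... | at-y e1 _ = ⊥-elim (y≢f (sym e1))
    ... | at-old eq′ = f∉Γ (lookupVar eq′)
    ... | at-f _ te with ⟶-injective te
    ... | refl , refl , refl = no-src-after-y ch s

  noLoops-pse : NoLoops Γ → NoLoops Γ′
  noLoops-pse i2 v a B b eq with lookup-cases v eq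
  ... | at-f _ te with ⟶-injective te
  ... | refl , refl , refl = λ e → y∉Γ (subst (_∈ Var Γ) e x∈Γ)
  noLoops-pse i2 v a B b eq | at-y _ te = i2 x a B b (trans lz (cong just (sym te)))
  noLoops-pse i2 v a B b eq | at-old eq′ = i2 v a B b eq′

  y-is-tgt : IsTgt Γ′ y
  y-is-tgt = f , x , A , E.lookup-f

  reachesFocus-pse : ReachesFocus Γ x → ReachesFocus Γ′ f
  reachesFocus-pse i3 c (here refl) nt = inj₂ ch0
  reachesFocus-pse i3 c (there (here refl)) nt = ⊥-elim (nt y-is-tgt)
  reachesFocus-pse i3 c (there (there m)) nt with i3 c m (λ t → nt (lift-tgt t))
  ... | inj₁ (e , ch , s) = inj₁ (e , lift-chain ch , lift-src s)
  ... | inj₂ ch = inj₁ (x , lift-chain ch , f , A , y , E.lookup-f)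

  f-not-tgt : ¬ IsTgt Γ′ f
  f-not-tgt (dd , a , B , eq) with lookup-cases dd eq
  ... | at-f _ te = y≢f (sym (proj₂ (proj₂ (⟶-injective te))))
  ... | at-y _ te = f∉Γ (lookupVar (proj₂ (key d (trans lz (cong just (sym te))))))
  ... | at-old eq′ = f∉Γ (lookupVar (proj₂ (key d eq′)))

  last-f : NoSrcAfter Γ x → NoLoops Γ → Last Γ′ f
  last-f i1 i2 = here refl , f-not-tgt , noSrcAfter-f i1 i2

  last-unique : ReachesFocus Γ x → ∀ c → Last Γ′ c → c ≡ f
  last-unique i3 c (here e , nt , ns) = e
  last-unique i3 c (there (here refl) , nt , ns) = ⊥-elim (nt y-is-tgt)
  last-unique i3 c (there (there m) , nt , ns) with i3 c m (λ t → nt (lift-tgt t))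
  ... | inj₁ (e , ch , s) = ⊥-elim (ns e (lift-chain ch) (lift-src s))
  ... | inj₂ ch = ⊥-elim (ns x (lift-chain ch) (f , A , y , E.lookup-f))

ps-invariants : ∀ {Γ z T} → Γ ⊢ps z ∶ T → NoSrcAfter Γ z × NoLoops Γ × ReachesFocus Γ z
ps-invariants (pss {x}) =
    (λ { e ch0 (dd , B , b , eq) → single-no-arrow x dd eq ; e (chS eq _) _ → single-no-arrow x x eq })
  , (λ v a B b eq → ⊥-elim (single-no-arrow x v eq))
  , (λ { c (here refl) nt → inj₂ ch0 })
ps-invariants (pst p) with ps-invariants p
... | i1 , i2 , i3 =
  let lf = ps-lookup p in
  (λ e ch → i1 e (chS lf ch)) , i2 ,
  (λ c m nt → map₂ (λ ch → chain-snoc ch lf) (i3 c m nt))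
ps-invariants (pse p y∉Γ f∉Γ y≢f) with ps-invariants p
... | i1 , i2 , i3 = P.noSrcAfter-f i1 i2 , P.noLoops-pse i2 , P.reachesFocus-pse i3
  where module P = PseInvariants p y∉Γ f∉Γ y≢f

≤-sum-map : ∀ (g : ℕ → ℕ) {L v} → v ∈ L → g v ≤ sum (map g L)
≤-sum-map g {x ∷ L} (here refl) = m≤m+n (g x) _
≤-sum-map g {x ∷ L} (there m) = ≤-trans (≤-sum-map g m) (m≤n+m _ (g x))

module InjectiveExtension (g : ℕ → ℕ) (L : List ℕ) (inj : InjOn g L) where
  M = suc (sum (map g L))
  ρ : ℕ → ℕ
  ρ v with v ∈? L
  ... | yes _ = g v
  ... | no _ = M + v

  ρ-on-L : ∀ v → v ∈ L → ρ v ≡ g v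
  ρ-on-L v m with v ∈? L
  ... | yes _ = refl
  ... | no nm = ⊥-elim (nm m)

  ρ-on-L≢outside : ∀ {u v} → u ∈ L → g u ≡ M + v → ⊥
  ρ-on-L≢outside m e = <-irrefl refl (≤-<-trans (≤-trans (m≤m+n M _) (≤-trans (≤-reflexive (sym e))
    (≤-sum-map g m))) (n<1+n _))

  ρ-injective : Injective _≡_ _≡_ ρ
  ρ-injective {u} {v} e with u ∈? L | v ∈? L
  ... | yes mu | yes mv = inj mu mv e
  ... | yes mu | no nv = ⊥-elim (ρ-on-L≢outside mu e)
  ... | no nu | yes mv = ⊥-elim (ρ-on-L≢outside mv (sym e))
  ... | no nu | no nv = +-cancelˡ-≡ M u v e

data PsView : Ctx → Set where
  vOne : ∀ x → PsView (∅ ▸ x ∶ ⋆)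
  vExt : ∀ {Γ₀ x A y f} (p : Γ₀ ⊢ps x ∶ A) (y∉Γ : y ∉ Var Γ₀) (f∉Γ : f ∉ Var Γ₀) (y≢f : y ≢ f)
       → PsView ((Γ₀ ▸ y ∶ A) ▸ f ∶ (x ⟶[ A ] y))

psView : ∀ {Γ z T} → Γ ⊢ps z ∶ T → PsView Γ
psView (pss {x}) = vOne x
psView (pst p) = psView p
psView (pse p y∉Γ f∉Γ y≢f) = vExt p y∉Γ f∉Γ y≢f

module IsoNames {Γ Δ} (d : Γ ⊢) (e : Δ ⊢) (φ : V d ≅G V e) where
  module G = NameMap d e (to φ)
  module H = NameMap e d (from φ)
  g = G.name
  h = H.name
  gP : ∀ v A → lookupTy Γ v ≡ just A → lookupTy Δ (g v) ≡ just (renT g A)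
  gP v A eq = G.name-lookupTy A v eq
  hP : ∀ v A → lookupTy Δ v ≡ just A → lookupTy Γ (h v) ≡ just (renT h A)
  hP v A eq = H.name-lookupTy A v eq
  hg : ∀ v → v ∈ Var Γ → h (g v) ≡ v
  hg v m = let (A , lv) = ∈Var⇒lookupTy Γ m
               c = cellOf {Γ} {v} lv
           in trans (cong h (sym (G.name-spec c))) (trans (sym (H.name-spec (fun (to φ) c)))
             (cong proj₁ (from∘to φ _ c)))
  gh : ∀ v → v ∈ Var Δ → g (h v) ≡ v
  gh v m = let (A , lv) = ∈Var⇒lookupTy Δ m
               c = cellOf {Δ} {v} lv
           in trans (cong g (sym (H.name-spec c))) (trans (sym (G.name-spec (fun (from φ) c)))
             (cong proj₁ (to∘from φ _ c)))
  gV : ∀ v → v ∈ Var Γ → g v ∈ Var Δ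
  gV v m = let (A , lv) = ∈Var⇒lookupTy Γ m in lookupVar (gP v A lv)
  ginj : InjOn g (Var Γ)
  ginj {u} {v} mu mv eq = trans (sym (hg u mu)) (trans (cong h eq) (hg v mv))

restrict-iso : ∀ {Γ₀ x A y f Δ₀ x′ A′ y′ f′}
  (d₀ : Γ₀ ⊢) (d : ((Γ₀ ▸ y ∶ A) ▸ f ∶ (x ⟶[ A ] y)) ⊢) (lz : lookupTy Γ₀ x ≡ just A)
  (e₀ : Δ₀ ⊢) (e : ((Δ₀ ▸ y′ ∶ A′) ▸ f′ ∶ (x′ ⟶[ A′ ] y′)) ⊢) (lz′ : lookupTy Δ₀ x′ ≡ just A′)
  (φ : V d ≅G V e) → NameMap.name d e (to φ) f ≡ f′ → NameMap.name d e (to φ) y ≡ y′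
  → Σ (V d₀ ≅G V e₀) λ φ₀ → ∀ v → v ∈ Var Γ₀ → NameMap.name d₀ e₀ (to φ₀) v ≡ NameMap.name d e (to φ) v
restrict-iso {Γ₀} {x} {A} {y} {f} {Δ₀} {x′} {A′} {y′} {f′} d₀ d lz e₀ e lz′ φ gf gy = φ₀ , agree
  where
  module P = NewCell d₀ d lz
  module Q = NewCell e₀ e lz′
  module F = IsoNames d e φ
  Γ = (Γ₀ ▸ y ∶ A) ▸ f ∶ (x ⟶[ A ] y)
  Δ = (Δ₀ ▸ y′ ∶ A′) ▸ f′ ∶ (x′ ⟶[ A′ ] y′)
  h-f′ : F.h f′ ≡ f
  h-f′ = trans (cong F.h (sym gf)) (F.hg f (here refl))
  h-y′ : F.h y′ ≡ y
  h-y′ = trans (cong F.h (sym gy)) (F.hg y (there (here refl)))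

  image-name : ∀ {n} (c : VCell Γ₀ n) → proj₁ (fun (to φ) (P.ι-fun c)) ≡ F.g (proj₁ c)
  image-name c = F.G.name-spec (P.ι-fun c)
  image≢f′ : ∀ {n} (c : VCell Γ₀ n) → proj₁ (fun (to φ) (P.ι-fun c)) ≢ f′
  image≢f′ c eq = P.old≢f m (trans (sym (F.hg (proj₁ c) (there (there m))))
                        (trans (cong F.h (sym (image-name c))) (trans (cong F.h eq) h-f′)))
    where m = cell∈Var Γ₀ c
  image≢y′ : ∀ {n} (c : VCell Γ₀ n) → proj₁ (fun (to φ) (P.ι-fun c)) ≢ y′
  image≢y′ c eq = P.old≢y m (trans (sym (F.hg (proj₁ c) (there (there m))))
                        (trans (cong F.h (sym (image-name c))) (trans (cong F.h eq) h-y′)))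
    where m = cell∈Var Γ₀ c

  restrict-to : ∀ {n} → VCell Γ₀ n → VCell Δ₀ n
  restrict-to c = proj₁ c′ , isCell-transport Δ Δ₀ (proj₁ c′) (Q.lookup-old (image≢f′ c) (image≢y′ c)) (proj₂ c′)
    where c′ = fun (to φ) (P.ι-fun c)

  restrict-from : ∀ {n} → VCell Δ₀ n → VCell Γ₀ n
  restrict-from c =
    let c′ = fun (from φ) (Q.ι-fun c)
        m = cell∈Var Δ₀ c
        nm : proj₁ c′ ≡ F.h (proj₁ c)
        nm = F.H.name-spec (Q.ι-fun c)
        a : proj₁ c′ ≢ f
        a = λ eq → Q.old≢f m (trans (sym (F.gh (proj₁ c) (there (there m)))) (trans (cong F.g (sym nm))
          (trans (cong F.g eq) gf)))
        b : proj₁ c′ ≢ y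
        b = λ eq → Q.old≢y m (trans (sym (F.gh (proj₁ c) (there (there m)))) (trans (cong F.g (sym nm))
          (trans (cong F.g eq) gy)))
    in proj₁ c′ , isCell-transport Γ Γ₀ (proj₁ c′) (P.lookup-old a b) (proj₂ c′)

  restrict-hom : GHom (V d₀) (V e₀)
  restrict-hom = record
    { fun = restrict-to
    ; fun-src = λ c → cellEq {Δ₀} (trans (cong (λ z → proj₁ (fun (to φ) z)) (fun-src P.ι c))
                       (trans (cong proj₁ (fun-src (to φ) (P.ι-fun c))) (cong (sM _) (Q.lookup-old (image≢f′ c) (image≢y′ c)))))
    ; fun-tgt = λ c → cellEq {Δ₀} (trans (cong (λ z → proj₁ (fun (to φ) z)) (fun-tgt P.ι c))
                       (trans (cong proj₁ (fun-tgt (to φ) (P.ι-fun c))) (cong (tM _) (Q.lookup-old (image≢f′ c) (image≢y′ c))))) }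

  φ₀ : V d₀ ≅G V e₀
  φ₀ = inverse⇒≅G restrict-hom restrict-from
    (λ n c → cellEq {Γ₀}
      (trans (cong (λ z → proj₁ (fun (from φ) z))
                   (cellEq {Δ} {c = Q.ι-fun (restrict-to c)} {c′ = fun (to φ) (P.ι-fun c)} refl))
             (cong proj₁ (from∘to φ n (P.ι-fun c)))))
    (λ n c → cellEq {Δ₀}
      (trans (cong (λ z → proj₁ (fun (to φ) z))
                   (cellEq {Γ} {c = P.ι-fun (restrict-from c)} {c′ = fun (from φ) (Q.ι-fun c)} refl))
             (cong proj₁ (to∘from φ n (Q.ι-fun c)))))

  agree : ∀ v → v ∈ Var Γ₀ → NameMap.name d₀ e₀ (to φ₀) v ≡ NameMap.name d e (to φ) v
  agree v m = let (B , lv) = ∈Var⇒lookupTy Γ₀ m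
                  c = cellOf {Γ₀} {v} lv
              in trans (sym (NameMap.name-spec d₀ e₀ (to φ₀) c)) (F.G.name-spec (P.ι-fun c))

pse-ctx-cong : ∀ {Δ₀ G₀ y′ gy A′ AA f′ ff x′ xx} → Δ₀ ≡ G₀ → y′ ≡ gy → A′ ≡ AA → f′ ≡ ff → x′ ≡ xx
      → ((Δ₀ ▸ y′ ∶ A′) ▸ f′ ∶ (x′ ⟶[ A′ ] y′)) ≡ ((G₀ ▸ gy ∶ AA) ▸ ff ∶ (xx ⟶[ AA ] gy))
pse-ctx-cong refl refl refl refl refl = refl

≅G⇒renaming : ∀ k {Γ Δ} → length (Var Γ) ≤ k → (d : Γ ⊢) (e : Δ ⊢) → PsView Γ → PsView Δ → (φ : V d ≅G V e)
       → Δ ≡ renC (NameMap.name d e (to φ)) Γ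
≅G⇒renaming k hk d e (vOne x) (vOne x′) φ with IsoNames.gV d e φ x (here refl)
... | here eq = cong (λ w → ∅ ▸ w ∶ ⋆) (sym eq)
≅G⇒renaming k hk d e (vOne x) (vExt {x = x′} {A = A′} {y = y′} {f = f′} p′ y′∉Δ f′∉Δ y′≢f′) φ =
  ⊥-elim (single-no-arrow x (IsoNames.h d e φ f′) (IsoNames.hP d e φ f′ _ (lookupTy-here _ f′ (x′ ⟶[ A′ ] y′))))
≅G⇒renaming k hk d e (vExt {x = x} {A = A} {y = y} {f = f} p y∉Γ f∉Γ y≢f) (vOne x′) φ =
  ⊥-elim (single-no-arrow x′ (IsoNames.g d e φ f) (IsoNames.gP d e φ f _ (lookupTy-here _ f (x ⟶[ A ] y))))
≅G⇒renaming zero () d e (vExt p y∉Γ f∉Γ y≢f) (vExt p′ y′∉Δ f′∉Δ y′≢f′) φ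
≅G⇒renaming (suc k) {Γ} {Δ} hk d e (vExt {Γ₀} {x} {A} {y} {f} p y∉Γ f∉Γ y≢f)
                                    (vExt {Δ₀} {x′} {A′} {y′} {f′} p′ y′∉Δ f′∉Δ y′≢f′) φ =
  pse-ctx-cong (trans IH (sym eR)) (sym gy) A′eq (sym gf) x′eq
  where
  module F = IsoNames d e φ
  i = ps-invariants p
  i′ = ps-invariants p′
  module PI = PseInvariants p y∉Γ f∉Γ y≢f
  module QI = PseInvariants p′ y′∉Δ f′∉Δ y′≢f′
  lastΔ = Last-transport Γ Δ F.g F.h F.gP F.hP F.hg f (PI.last-f (proj₁ i) (proj₁ (proj₂ i)))
  gf : F.g f ≡ f′
  gf = QI.last-unique (proj₂ (proj₂ i′)) (F.g f) lastΔ
  tyEq : (x′ ⟶[ A′ ] y′) ≡ (F.g x ⟶[ renT F.g A ] F.g y)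
  tyEq = just-injective (trans (sym (lookupTy-here _ f′ (x′ ⟶[ A′ ] y′))) (trans
    (cong (lookupTy Δ) (sym gf)) (F.gP f _ (lookupTy-here _ f (x ⟶[ A ] y)))))
  x′eq = proj₁ (⟶-injective tyEq)
  A′eq = proj₁ (proj₂ (⟶-injective tyEq))
  gy : F.g y ≡ y′
  gy = sym (proj₂ (proj₂ (⟶-injective tyEq)))
  d₀ = ps-ctx p
  e₀ = ps-ctx p′
  restricted = restrict-iso d₀ d (ps-lookup p) e₀ e (ps-lookup p′) φ gf gy
  φ₀ = proj₁ restricted
  hk′ : length (Var Γ₀) ≤ k
  hk′ = lemk hk
    where
    lemk : ∀ {a} → suc (suc a) ≤ suc k → a ≤ k
    lemk (s≤s q) = ≤-trans (n≤1+n _) q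
  IH : Δ₀ ≡ renC (NameMap.name d₀ e₀ (to φ₀)) Γ₀
  IH = ≅G⇒renaming k hk′ d₀ e₀ (psView p) (psView p′) φ₀
  eR : renC F.g Γ₀ ≡ renC (NameMap.name d₀ e₀ (to φ₀)) Γ₀
  eR = renC-cong F.g (NameMap.name d₀ e₀ (to φ₀)) d₀ (λ v m → sym (proj₂ restricted v m))

≅G⇒≈α : ∀ {Γ Δ} (d : Γ ⊢) (e : Δ ⊢) → Γ ⊢ps → Δ ⊢ps → V d ≅G V e → Γ ≈α Δ
≅G⇒≈α {Γ} d e (psc p) (psc p′) φ =
  let module F = IsoNames d e φ
      eq = ≅G⇒renaming (length (Var Γ)) ≤-refl d e (psView p) (psView p′) φ
      module X = InjectiveExtension F.g (Var Γ) F.ginj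
  in X.ρ , X.ρ-injective , trans eq (renC-cong F.g X.ρ d (λ v m → sym (X.ρ-on-L v m)))


ps-close : ∀ {Γ z} T → Γ ⊢ps z ∶ T → Γ ⊢ps
ps-close ⋆ p = psc p
ps-close (a ⟶[ B ] b) p = ps-close B (pst p)

V-pasting-scheme : ∀ {Γ} (d : Γ ⊢) → Γ ⊢ps → IsPastingScheme (V d)
V-pasting-scheme d ps with ps⇒Canonical ps
... | 𝒟 , ρ , ρ-injective , Γ≡ρ =
  𝒟 , V-Canonical 𝒟 , proj₁ colimit , proj₂ colimit , renaming⇒≅G d (valid (Canonical-wf 𝒟)) ρ ρ-injective Γ≡ρ
  where colimit = V-Canonical-isColimit 𝒟

pasting-scheme-is-V : ∀ X → IsPastingScheme X → Σ Ctx λ Γ → Σ (Γ ⊢) λ d → Γ ⊢ps × (X ≅G V d)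
pasting-scheme-is-V X (𝒟 , L , c , isColimit , X≅L) =
  ctx (Canonical 𝒟) , valid wf , ps-close _ (proj₁ wf) ,
  ≅G-trans X≅L (colimit-unique c isColimit (proj₁ colimit) (proj₂ colimit))
  where
  wf = Canonical-wf 𝒟
  colimit = V-Canonical-isColimit 𝒟

theorem4p5 :
      (∀ Γ → Γ ⊢ps → Γ ⊢)
    × (∀ Γ (d : Γ ⊢) → Γ ⊢ps → IsPastingScheme (V d))
    × (∀ Γ Δ (d : Γ ⊢) (e : Δ ⊢) → Γ ⊢ps → Δ ⊢ps
         → (Γ ≈α Δ → V d ≅G V e) × (V d ≅G V e → Γ ≈α Δ))
    × (∀ X → IsPastingScheme X → Σ Ctx λ Γ → Σ (Γ ⊢) λ d → Γ ⊢ps × (X ≅G V d))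
    × (∀ Γ Δ (d : Γ ⊢) (e : Δ ⊢) → Γ ⊢ps → Δ ⊢ps → (f : GHom (V d) (V e))
         → Σ Sub λ γ → (Δ ⊢s γ ∶ Γ)
             × (∀ n (c : Cell (V d) n) → proj₁ (fun f c) ≡ proj₁ c [ γ ]v))
    × (∀ Γ Δ (d : Γ ⊢) γ γ′ → Γ ⊢ps → Δ ⊢ps → Δ ⊢s γ ∶ Γ → Δ ⊢s γ′ ∶ Γ
         → (∀ n (c : Cell (V d) n) → proj₁ c [ γ ]v ≡ proj₁ c [ γ′ ]v)
         → γ ≡ γ′)
theorem4p5 =
    (λ _ → ps-valid)
  , (λ _ → V-pasting-scheme)
  , (λ _ _ d e Γ-ps Δ-ps → ≈α⇒≅G d e , ≅G⇒≈α d e Γ-ps Δ-ps)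
  , pasting-scheme-is-V
  , (λ _ _ d e _ _ → V-full d e)
  , (λ _ _ d _ _ _ _ → V-faithful d)
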